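{- Let $\varepsilon>0$ be a constant and let $m=m(n)$ be a positive integer with $m\le \lfloor (2+\varepsilon)^{ -1}(\log n)^{ -1/2}n^{1/2}\rfloor$. Let $B_m$ be the number of balanced cliques of size $m$ in $C_n$. Then $\mathbb{P}(B_m\ge 1)\to 1$ as $n\to\infty$.
   Context: A chord diagram of size $n$ is a perfect matching of the points $1,\dots,2n$ placed clockwise on a circle; $C_n$ is a uniformly random chord diagram of size $n$. Two chords cross if their endpoints interleave on the circle; a clique is a set of pairwise crossing chords. With $r=\lfloor n/m\rfloor$, a balanced clique of size $m$ is a clique of $m$ chords such that each of the $2m$ blocks $[1,r],[r+1,2r],\dots,[(2m-1)r+1,2mr]$ contains exactly one endpoint of the clique's chords. $\log$ is the natural logarithm.
   Formalization: The constant ε ranges over the positive rationals. -}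

module Defs where

open import Data.Nat using (ℕ; zero; suc; _+_; _*_; _∸_; _^_; _≤_; _<_; _⊔_; _⊓_; NonZero; _!)
open import Data.Nat.DivMod using (_/_)

open import Data.Fin using (Fin; toℕ)
open import Data.Fin.Subset using (Subset; _∈_; ∣_∣)
open import Data.Vec using (Vec; lookup)
open import Data.List using (List; length)
open import Data.List.Relation.Unary.All using (All)
open import Data.List.Relation.Unary.Unique.Propositional using (Unique)
open import Data.Product using (Σ; ∃; _×_)
open import Data.Sum using (_⊎_)
open import Relation.Nullary using (¬_)
open import Relation.Binary.PropositionalEquality using (_≡_)

-- Points 1,…,2n on the circle are represented (0-indexed) by Fin (2 * n):
-- the point k+1 corresponds to the element with toℕ = k.
-- A candidate diagram is a vector assigning to each point its partner.

Diagram : ℕ → Set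
Diagram n = Vec (Fin (2 * n)) (2 * n)

partner : ∀ n → Diagram n → Fin (2 * n) → Fin (2 * n)
partner n D x = lookup D x

IsChordDiagram : ∀ n → Diagram n → Set
IsChordDiagram n D = ∀ x → (partner n D (partner n D x) ≡ x) × ¬ (partner n D x ≡ x)

-- Chord {a,b} (a<b) and chord {c,d} (c<d) cross iff endpoints interleave.
Interleave : ℕ → ℕ → ℕ → ℕ → Set
Interleave a b c d = (a < c × c < b × b < d) ⊎ (c < a × a < d × d < b)

Crosses : ∀ n → Diagram n → Fin (2 * n) → Fin (2 * n) → Set
Crosses n D x y =
  Interleave (toℕ x ⊓ toℕ (partner n D x)) (toℕ x ⊔ toℕ (partner n D x))
             (toℕ y ⊓ toℕ (partner n D y)) (toℕ y ⊔ toℕ (partner n D y))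

blockLen : (n m : ℕ) → .{{NonZero m}} → ℕ
blockLen n m = n / m

-- Point x (0-indexed) lies in block j (0-indexed), i.e. point x+1 lies in
-- [j r + 1, (j+1) r].
InBlock : (n m : ℕ) → .{{NonZero m}} → ℕ → Fin (2 * n) → Set
InBlock n m j x = (j * blockLen n m ≤ toℕ x) × (toℕ x < suc j * blockLen n m)

IsBalancedClique : (n m : ℕ) → .{{NonZero m}} → Diagram n → Subset (2 * n) → Set
IsBalancedClique n m D S =
  (∀ x → x ∈ S → partner n D x ∈ S) ×
  (∣ S ∣ ≡ 2 * m) ×
  (∀ x y → x ∈ S → y ∈ S → ¬ (y ≡ x) → ¬ (y ≡ partner n D x) → Crosses n D x y) ×
  (∀ (j : Fin (2 * m)) →
     Σ (Fin (2 * n)) λ x → (x ∈ S) × InBlock n m (toℕ j) x ×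
       (∀ y → y ∈ S → InBlock n m (toℕ j) y → y ≡ x))

HasBalancedClique : (n m : ℕ) → .{{NonZero m}} → Diagram n → Set
HasBalancedClique n m D = ∃ λ S → IsBalancedClique n m D S

-- P(B_m ≥ 1) ≥ 1 - p/q for the uniform chord diagram C_n:
-- (#diagrams with B_m ≥ 1) * q ≥ (q - p) * (#all chord diagrams).
-- Stated without computing the counts: there is a duplicate-free list of
-- good diagrams whose length, times q, dominates (q - p) times the length of
-- any duplicate-free list of chord diagrams.
ProbAtLeastOneMinus : (n m : ℕ) → .{{NonZero m}} → (p q : ℕ) → Set
ProbAtLeastOneMinus n m p q =
  Σ (List (Diagram n)) λ good →
    Unique good × All (λ D → IsChordDiagram n D × HasBalancedClique n m D) good ×
    ((all : List (Diagram n)) → Unique all → All (IsChordDiagram n) all →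
       (q ∸ p) * length all ≤ q * length good)

-- Exponential comparison without reals.
-- expPartial P k = k! * Σ_{j=0}^{k} P^j / j!  (a natural number).
expPartial : ℕ → ℕ → ℕ
expPartial P zero = 1
expPartial P (suc k) = suc k * expPartial P k + P ^ suc k

-- "M ≤ e^P": some partial sum of the exponential series reaches M.
-- (For M = n^Q with n ≥ 2, Q ≥ 1, e^P ≠ M by transcendence of e, so this
-- is exactly M ≤ e^P.)
ExpAtLeast : ℕ → ℕ → Set
ExpAtLeast P M = ∃ λ k → M * (k !) ≤ expPartial P k

-- With ε = a/b (a, b ≥ 1), n ≥ 2, m ≥ 1:
--   m ≤ ⌊ (2+ε)^{-1} (log n)^{-1/2} n^{1/2} ⌋
--   ⇔ m² (2+ε)² log n ≤ n
--   ⇔ m² (2b+a)² log n ≤ n b²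
--   ⇔ n ^ (m² (2b+a)²) ≤ e ^ (n b²).
MBound : (a b n m : ℕ) → Set
MBound a b n m = ExpAtLeast (n * (b * b)) (n ^ (m * m * ((2 * b + a) * (2 * b + a))))

{-# OPTIONS --safe #-}
-- A balanced clique exists as soon as, for every i < m, some chord joins block i to block m + i:
-- chords with one endpoint in each of the blocks i < m + i are forced to cross pairwise. Expose the
-- matching by repeatedly pairing the first unpaired point, listing the r = ⌊n/m⌋ points of block i
-- first. During the first s = ⌊r/2⌋ steps the point being paired lies in block i, and at least r of
-- its at most N = 2n - 1 possible partners lie in block m + i; so block i stays unjoined with
-- probability at most (1 - r/N)^s, and by the union bound some block stays unjoined with probability
-- at most m (1 - r/N)^s. Since (1 - r/N)^-t ≥ e^(tr/N), the hypothesis m²(2+ε)² log n ≤ n makes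
-- this at most 1/q for large n. Probabilities are ratios of counts in an explicit duplicate-free
-- enumeration of all chord diagrams.

module Submission where

open import Defs
open import Data.Bool using (Bool; true; false; not; _∧_; _∨_; T)
open import Data.Bool.ListAction using (any; or)
open import Data.Bool.Properties using (T-∧)
open import Data.Empty using (⊥; ⊥-elim)
open import Data.Fin using (Fin; toℕ; zero; suc; _≟_)
open import Data.Fin.Properties using (toℕ<n)
open import Data.Fin.Subset using (Subset; ∣_∣; ⁅_⁆; _∪_) renaming (⊥ to ∅; _∈_ to _∈ₛ_; _∉_ to _∉ₛ_)
open import Data.Fin.Subset.Properties using (∉⊥; ∣⊥∣≡0; ∣⁅x⁆∣≡1; x∈⁅x⁆; x∈⁅y⁆⇒x≡y; x∈p∪q⁺; x∈p∪q⁻)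
import Data.List as List
open import Data.List using (List; []; _∷_; [_]; _++_; map; concatMap; length; filterᵇ; allFin; upTo)
open import Data.List.Properties
  using (length-++; length-filter; filter-++; filter-none; filter-all; filter-reject; length-map; length-tabulate;
         length-upTo; map-cong; map-tabulate; map-∘)
open import Data.List.Membership.Propositional using (_∈_; _∉_; find)
open import Data.List.Membership.Propositional.Properties
  using (∈-filter⁺; ∈-filter⁻; ∈-∃++; ∈-++⁻; ∈-++⁺ˡ; ∈-++⁺ʳ; ∈-map⁻; ∈-map⁺; ∈-concatMap⁺; ∈-concatMap⁻;
         ∈-allFin; ∈-upTo⁺; ∈-upTo⁻)
open import Data.List.Relation.Binary.Permutation.Propositional using (_↭_; ↭-refl; ↭-sym; ↭-trans; prep; swap; ↭⇒↭ₛ)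
open import Data.List.Relation.Binary.Permutation.Propositional.Properties using (↭-length; filter-↭; ∈-resp-↭)
import Data.List.Relation.Binary.Permutation.Setoid.Properties as PermutationSetoid
open import Data.List.Relation.Binary.Subset.Propositional using (_⊆_)
import Data.List.Relation.Unary.All as All
import Data.List.Relation.Unary.All.Properties as All
open import Data.List.Relation.Unary.AllPairs using (AllPairs; []; _∷_) renaming (map to AllPairs-map)
import Data.List.Relation.Unary.AllPairs.Properties as AllPairs
import Data.List.Relation.Unary.Any as Any
open import Data.List.Relation.Unary.Any using (here; there)
open import Data.List.Relation.Unary.Any.Properties using (any⁺; any⁻)
open import Data.List.Relation.Unary.Unique.Propositional using (Unique)
import Data.List.Relation.Unary.Unique.Propositional.Properties as Unique
open import Data.Nat
  using (ℕ; zero; suc; pred; _+_; _*_; _∸_; _^_; _⊓_; _⊔_; _≤_; _<_; _≤?_; _<?_; _<ᵇ_; z≤n; s≤s; s≤s⁻¹;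
         _!; NonZero; >-nonZero; >-nonZero⁻¹)
open import Data.Nat.DivMod using (_/_; _%_; m≡m%n+[m/n]*n; m%n<n; m/n*n≤m; m/n≤m)
open import Data.Nat.ListAction using (sum)
open import Data.Nat.Properties hiding (_≟_)
open import Algebra.Properties.CommutativeSemigroup *-commutativeSemigroup using (interchange; x∙yz≈y∙xz; x∙yz≈yx∙z)
open import Data.Nat.Tactic.RingSolver using (solve-∀)
open import Data.Product using (Σ; ∃; ∃-syntax; _×_; _,_; proj₁; proj₂; map₂)
open import Data.Sum using (_⊎_; inj₁; inj₂) renaming (map to map-⊎)
open import Data.Unit using (⊤; tt)
open import Data.Vec using ([]; _∷_; tabulate; lookup; here; there)
open import Data.Vec.Properties using (lookup∘tabulate; tabulate∘lookup; tabulate-cong)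
open import Function using (_∘_; const)
open import Function.Bundles using (Equivalence)
open import Relation.Binary.Definitions using (DecidableEquality; tri<; tri≈; tri>)
open import Relation.Binary.PropositionalEquality hiding ([_])
open import Relation.Nullary using (¬_; yes; no; contradiction)
open import Relation.Nullary.Decidable using (T?)



-- Counting with Boolean predicates

¬T⇒≡false : ∀ {b} → ¬ T b → b ≡ false
¬T⇒≡false {false} _ = refl
¬T⇒≡false {true} ¬t = ⊥-elim (¬t _)

¬T-not⇒T : ∀ {b} → ¬ T (not b) → T b
¬T-not⇒T {true} _ = _
¬T-not⇒T {false} ¬t = ¬t _

T-not⇒¬T : ∀ {b} → T (not b) → ¬ T b
T-not⇒¬T {false} _ ()

T⇒¬T-not : ∀ {b} → T b → ¬ T (not b)
T⇒¬T-not {true} _ ()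

module _ {A : Set} where

  count : (A → Bool) → List A → ℕ
  count p xs = length (filterᵇ p xs)

  count-++ : ∀ p xs ys → count p (xs ++ ys) ≡ count p xs + count p ys
  count-++ p xs ys = trans (cong length (filter-++ (T? ∘ p) xs ys)) (length-++ (filterᵇ p xs))

  count≤length : ∀ p xs → count p xs ≤ length xs
  count≤length p = length-filter (T? ∘ p)

  count-const-true : ∀ xs → count (const true) xs ≡ length xs
  count-const-true xs = cong length (filter-all (T? ∘ const true) (All.universal _ xs))

  count-↭ : ∀ p {xs ys} → xs ↭ ys → count p xs ≡ count p ys
  count-↭ p σ = ↭-length (filter-↭ (T? ∘ p) σ)

  count-∷-reject : ∀ {p x} xs → ¬ T (p x) → count p (x ∷ xs) ≡ count p xs
  count-∷-reject {p} xs ¬px = cong length (filter-reject (T? ∘ p) ¬px)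

  count-none : ∀ {p} xs → (∀ {x} → x ∈ xs → ¬ T (p x)) → count p xs ≡ 0
  count-none {p} xs none = cong length (filter-none (T? ∘ p) (All.tabulate none))

  count-cong : ∀ {p q} xs → (∀ {x} → x ∈ xs → p x ≡ q x) → count p xs ≡ count q xs
  count-cong [] eq = refl
  count-cong {p} {q} (x ∷ xs) eq with p x | q x | eq (here refl)
  ... | true  | true  | _ = cong suc (count-cong xs (eq ∘ there))
  ... | false | false | _ = count-cong xs (eq ∘ there)

  count-complement : ∀ p xs → count p xs + count (not ∘ p) xs ≡ length xs
  count-complement p [] = refl
  count-complement p (x ∷ xs) with p x
  ... | true  = cong suc (count-complement p xs)
  ... | false = trans (+-suc _ _) (cong suc (count-complement p xs))

  count-∨ : ∀ p q xs → count (λ x → p x ∨ q x) xs ≤ count p xs + count q xs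
  count-∨ p q [] = z≤n
  count-∨ p q (x ∷ xs) with p x | q x
  ... | true  | true  = s≤s (≤-trans (count-∨ p q xs) (+-monoʳ-≤ (count p xs) (n≤1+n _)))
  ... | true  | false = s≤s (count-∨ p q xs)
  ... | false | true  = ≤-trans (s≤s (count-∨ p q xs)) (≤-reflexive (sym (+-suc _ _)))
  ... | false | false = count-∨ p q xs

  length-mono-⊆ : ∀ {xs ys : List A} → Unique xs → xs ⊆ ys → length xs ≤ length ys
  length-mono-⊆ {[]} _ _ = z≤n
  length-mono-⊆ {x ∷ xs} (x≢xs ∷ uxs) sub with ∈-∃++ (sub (here refl))
  ... | ys₁ , ys₂ , refl = begin
    suc (length xs)              ≤⟨ s≤s (length-mono-⊆ uxs sub′) ⟩
    suc (length (ys₁ ++ ys₂))    ≡⟨ cong suc (length-++ ys₁) ⟩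
    suc (length ys₁ + length ys₂) ≡⟨ +-suc _ _ ⟨
    length ys₁ + length (x ∷ ys₂) ≡⟨ length-++ ys₁ ⟨
    length (ys₁ ++ x ∷ ys₂)      ∎
    where
    open ≤-Reasoning
    sub′ : xs ⊆ ys₁ ++ ys₂
    sub′ z∈xs with ∈-++⁻ ys₁ (sub (there z∈xs))
    ... | inj₁ z∈ys₁         = ∈-++⁺ˡ z∈ys₁
    ... | inj₂ (here refl)   = ⊥-elim (All.All¬⇒¬Any x≢xs z∈xs)
    ... | inj₂ (there z∈ys₂) = ∈-++⁺ʳ ys₁ z∈ys₂

  count-mono : ∀ p {xs ys} → Unique xs → (∀ {x} → x ∈ xs → T (p x) → x ∈ ys) → count p xs ≤ count p ys
  count-mono p uxs sub = length-mono-⊆ (Unique.filter⁺ (T? ∘ p) uxs) λ x∈ →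
    let (x∈xs , px) = ∈-filter⁻ (T? ∘ p) x∈ in ∈-filter⁺ (T? ∘ p) (sub x∈xs px) px

  sum-≤-count : ∀ (good : A → Bool) (h : A → ℕ) W V es →
    (∀ {e} → e ∈ es → ¬ T (good e) → h e ≡ 0) → (∀ {e} → e ∈ es → T (good e) → h e * W ≤ V) →
    sum (map h es) * W ≤ count good es * V
  sum-≤-count good h W V [] _ _ = z≤n
  sum-≤-count good h W V (e ∷ es) bad≡0 good≤ with good e | bad≡0 (here refl) | good≤ (here refl)
  ... | false | he≡0 | _ rewrite he≡0 (λ ()) = sum-≤-count good h W V es (bad≡0 ∘ there) (good≤ ∘ there)
  ... | true  | _ | he≤ = begin
    (h e + sum (map h es)) * W     ≡⟨ *-distribʳ-+ W (h e) _ ⟩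
    h e * W + sum (map h es) * W   ≤⟨ +-mono-≤ (he≤ _) (sum-≤-count good h W V es (bad≡0 ∘ there) (good≤ ∘ there)) ⟩
    V + count good es * V          ∎
    where open ≤-Reasoning

module _ {A B : Set} where

  count-map : ∀ p (g : A → B) xs → count p (map g xs) ≡ count (p ∘ g) xs
  count-map p g [] = refl
  count-map p g (x ∷ xs) with p (g x)
  ... | true  = cong suc (count-map p g xs)
  ... | false = count-map p g xs

  count-concatMap : ∀ p (g : A → List B) xs → count p (concatMap g xs) ≡ sum (map (count p ∘ g) xs)
  count-concatMap p g [] = refl
  count-concatMap p g (x ∷ xs) = trans (count-++ p (g x) _) (cong (count p (g x) +_) (count-concatMap p g xs))

  count-any≤sum : ∀ (h : A → B → Bool) is xs →
    count (λ x → any (λ i → h i x) is) xs ≤ sum (map (λ i → count (h i) xs) is)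
  count-any≤sum h [] xs = ≤-reflexive (count-none xs (λ _ ()))
  count-any≤sum h (i ∷ is) xs = ≤-trans (count-∨ (h i) _ xs) (+-monoʳ-≤ (count (h i) xs) (count-any≤sum h is xs))

  length-concatMap-const : ∀ (g : A → List B) xs c → (∀ {x} → x ∈ xs → length (g x) ≡ c) →
    length (concatMap g xs) ≡ length xs * c
  length-concatMap-const g [] c _ = refl
  length-concatMap-const g (x ∷ xs) c eq =
    trans (length-++ (g x)) (cong₂ _+_ (eq (here refl)) (length-concatMap-const g xs c (eq ∘ there)))

-- Removing one element from a list

module _ {A : Set} where

  removals : List A → List (A × List A)
  removals [] = []
  removals (x ∷ xs) = (x , xs) ∷ map (map₂ (x ∷_)) (removals xs)

  map-proj₁-removals : ∀ xs → map proj₁ (removals xs) ≡ xs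
  map-proj₁-removals [] = refl
  map-proj₁-removals (x ∷ xs) = cong (x ∷_) (trans (sym (map-∘ (removals xs))) (map-proj₁-removals xs))

  length-removals : ∀ xs → length (removals xs) ≡ length xs
  length-removals xs = trans (sym (length-map proj₁ (removals xs))) (cong length (map-proj₁-removals xs))

  removals-↭ : ∀ {xs y rest} → (y , rest) ∈ removals xs → xs ↭ y ∷ rest
  removals-↭ {x ∷ xs} (here refl) = ↭-refl
  removals-↭ {x ∷ xs} (there p) with ∈-map⁻ (map₂ (x ∷_)) p
  ... | (y , rest) , q , refl = ↭-trans (prep x (removals-↭ q)) (swap x y ↭-refl)

  ∈⇒∈-removals : ∀ {xs y} → y ∈ xs → ∃ λ rest → (y , rest) ∈ removals xs
  ∈⇒∈-removals {x ∷ xs} (here refl) = xs , here refl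
  ∈⇒∈-removals {x ∷ xs} (there y∈xs) with ∈⇒∈-removals y∈xs
  ... | rest , q = x ∷ rest , there (∈-map⁺ (map₂ (x ∷_)) q)

  module _ {xs y rest} (r∈ : (y , rest) ∈ removals xs) where

    removed∈ : y ∈ xs
    removed∈ = ∈-resp-↭ (↭-sym (removals-↭ r∈)) (here refl)

    remaining⊆ : ∀ {z} → z ∈ rest → z ∈ xs
    remaining⊆ = ∈-resp-↭ (↭-sym (removals-↭ r∈)) ∘ there

    removed-or-remaining : ∀ {z} → z ∈ xs → z ≡ y ⊎ z ∈ rest
    removed-or-remaining z∈ with ∈-resp-↭ (removals-↭ r∈) z∈
    ... | here z≡y = inj₁ z≡y
    ... | there z∈rest = inj₂ z∈rest

    length-remaining : length xs ≡ suc (length rest)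
    length-remaining = ↭-length (removals-↭ r∈)

    Unique-removals : Unique xs → y ∉ rest × Unique rest
    Unique-removals uxs with PermutationSetoid.Unique-resp-↭ (setoid A) (↭⇒↭ₛ (removals-↭ r∈)) uxs
    ... | y≢rest ∷ urest = All.All¬⇒¬Any y≢rest , urest

  module _ (p : A → Bool) where

    AllFirst : ℕ → List A → Set
    AllFirst zero    _        = ⊤
    AllFirst (suc k) []       = ⊥
    AllFirst (suc k) (x ∷ xs) = T (p x) × AllFirst k xs

    AllFirst-removals : ∀ k {xs y rest} → AllFirst (suc k) xs → (y , rest) ∈ removals xs → AllFirst k rest
    AllFirst-removals k {x ∷ xs} (_ , first) (here refl) = first
    AllFirst-removals zero {x ∷ xs} _ (there _) = tt
    AllFirst-removals (suc k) {x ∷ xs} (px , first) (there r∈) with ∈-map⁻ (map₂ (x ∷_)) r∈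
    ... | _ , r∈′ , refl = px , AllFirst-removals k first r∈′

    toFront : List A → List A
    toFront xs = filterᵇ p xs ++ filterᵇ (not ∘ p) xs

    AllFirst-++ : ∀ k {xs} ys → All.All (T ∘ p) xs → k ≤ length xs → AllFirst k (xs ++ ys)
    AllFirst-++ zero    ys _ _ = tt
    AllFirst-++ (suc k) ys (px All.∷ pxs) (s≤s k≤) = px , AllFirst-++ k ys pxs k≤

    AllFirst-toFront : ∀ k xs → k ≤ count p xs → AllFirst k (toFront xs)
    AllFirst-toFront k xs k≤ = AllFirst-++ k _ (All.tabulate (λ x∈ → proj₂ (∈-filter⁻ (T? ∘ p) {xs = xs} x∈))) k≤

    ∈-toFront : ∀ {xs x} → x ∈ xs → x ∈ toFront xs
    ∈-toFront {xs} {x} x∈ with p x in px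
    ... | true  = ∈-++⁺ˡ (∈-filter⁺ (T? ∘ p) x∈ (subst T (sym px) tt))
    ... | false = ∈-++⁺ʳ (filterᵇ p xs) (∈-filter⁺ (T? ∘ (not ∘ p)) x∈ (subst (T ∘ not) (sym px) tt))

    Unique-toFront : ∀ {xs} → Unique xs → Unique (toFront xs)
    Unique-toFront {xs} uxs = Unique.++⁺ (Unique.filter⁺ (T? ∘ p) uxs) (Unique.filter⁺ (T? ∘ (not ∘ p)) uxs)
      λ (x∈₁ , x∈₂) → T-not⇒¬T (proj₂ (∈-filter⁻ (T? ∘ (not ∘ p)) {xs = xs} x∈₂))
                                (proj₂ (∈-filter⁻ (T? ∘ p) {xs = xs} x∈₁))

    length-toFront : ∀ xs → length (toFront xs) ≡ length xs
    length-toFront xs = trans (length-++ (filterᵇ p xs)) (count-complement p xs)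

-- Perfect matchings of a list

module Matchings {A : Set} (_≟_ : DecidableEquality A) where

  Pairing : Set
  Pairing = List (A × A)

  partnerIn : Pairing → A → A
  partnerIn [] z = z
  partnerIn ((a , b) ∷ π) z with z ≟ a | z ≟ b
  ... | yes _ | _     = b
  ... | no _  | yes _ = a
  ... | no _  | no _  = partnerIn π z

  partnerIn-head : ∀ a b π → partnerIn ((a , b) ∷ π) a ≡ b
  partnerIn-head a b π with a ≟ a
  ... | yes _ = refl
  ... | no a≢a = ⊥-elim (a≢a refl)

  partnerIn-head′ : ∀ a b π → b ≢ a → partnerIn ((a , b) ∷ π) b ≡ a
  partnerIn-head′ a b π b≢a with b ≟ a | b ≟ b
  ... | yes b≡a | _ = ⊥-elim (b≢a b≡a)
  ... | no _ | yes _ = refl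
  ... | no _ | no b≢b = ⊥-elim (b≢b refl)

  partnerIn-tail : ∀ a b π {z} → z ≢ a → z ≢ b → partnerIn ((a , b) ∷ π) z ≡ partnerIn π z
  partnerIn-tail a b π {z} z≢a z≢b with z ≟ a | z ≟ b
  ... | yes z≡a | _ = ⊥-elim (z≢a z≡a)
  ... | no _ | yes z≡b = ⊥-elim (z≢b z≡b)
  ... | no _ | no _ = refl

  -- The fuel f bounds the number of chords; the head of the list is always paired first.
  mutual
    matchings : ℕ → List A → List Pairing
    matchings _       []       = [ [] ]
    matchings zero    (_ ∷ _)  = []
    matchings (suc f) (x ∷ xs) = concatMap (pairHeadWith f x) (removals xs)

    pairHeadWith : ℕ → A → A × List A → List Pairing
    pairHeadWith f x (y , rest) = map ((x , y) ∷_) (matchings f rest)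

  ∈-matchings⁻ : ∀ {f x xs π} → π ∈ matchings (suc f) (x ∷ xs) →
    ∃[ y ] ∃[ rest ] ∃[ π′ ] (y , rest) ∈ removals xs × π′ ∈ matchings f rest × π ≡ (x , y) ∷ π′
  ∈-matchings⁻ {f} {x} {xs} π∈ with find (∈-concatMap⁻ (pairHeadWith f x) {removals xs} π∈)
  ... | (y , rest) , r∈ , π∈′ with ∈-map⁻ ((x , y) ∷_) π∈′
  ... | π′ , π′∈ , refl = y , rest , π′ , r∈ , π′∈ , refl

  ∈-matchings⁺ : ∀ {f x xs y rest π′} → (y , rest) ∈ removals xs → π′ ∈ matchings f rest →
    (x , y) ∷ π′ ∈ matchings (suc f) (x ∷ xs)
  ∈-matchings⁺ {f} {x} {y = y} r∈ π′∈ =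
    ∈-concatMap⁺ (pairHeadWith f x) (Any.map (λ { refl → ∈-map⁺ ((x , y) ∷_) π′∈ }) r∈)

  record IsPerfectMatchingOn (ps : List A) (g : A → A) : Set where
    field
      closed       : ∀ {z} → z ∈ ps → g z ∈ ps
      involutive   : ∀ {z} → z ∈ ps → g (g z) ≡ z
      fixpointFree : ∀ {z} → z ∈ ps → g z ≢ z

  matchings-fix-outside : ∀ {f ps π z} → π ∈ matchings f ps → z ∉ ps → partnerIn π z ≡ z
  matchings-fix-outside {ps = []} (here refl) _ = refl
  matchings-fix-outside {suc f} {x ∷ xs} {z = z} π∈ z∉ with ∈-matchings⁻ {f} {x} {xs} π∈
  ... | y , rest , π′ , r∈ , π′∈ , refl =
    trans (partnerIn-tail x y π′ (z∉ ∘ here) (λ { refl → z∉ (there (removed∈ r∈)) }))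
          (matchings-fix-outside π′∈ (z∉ ∘ there ∘ remaining⊆ r∈))

  module _ {x y : A} {xs rest} (x∉xs : x ∉ xs) (r∈ : (y , rest) ∈ removals xs) (y∉rest : y ∉ rest) where

    x≢removed : x ≢ y
    x≢removed refl = x∉xs (removed∈ r∈)

    x∉remaining : x ∉ rest
    x∉remaining = x∉xs ∘ remaining⊆ r∈

    partnerIn-remaining : ∀ π {z} → z ∈ rest → partnerIn ((x , y) ∷ π) z ≡ partnerIn π z
    partnerIn-remaining π z∈ = partnerIn-tail x y π (λ { refl → x∉remaining z∈ }) (λ { refl → y∉rest z∈ })

    paired-or-remaining : ∀ {z} → z ∈ x ∷ xs → z ≡ x ⊎ z ≡ y ⊎ z ∈ rest
    paired-or-remaining (here z≡x) = inj₁ z≡x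
    paired-or-remaining (there z∈) = inj₂ (removed-or-remaining r∈ z∈)

  matchings-sound : ∀ {f ps π} → Unique ps → π ∈ matchings f ps → IsPerfectMatchingOn ps (partnerIn π)
  matchings-sound {ps = []} _ (here refl) = record { closed = λ () ; involutive = λ () ; fixpointFree = λ () }
  matchings-sound {suc f} {x ∷ xs} (x≢xs ∷ uxs) π∈ with ∈-matchings⁻ {f} {x} {xs} π∈
  ... | y , rest , π′ , r∈ , π′∈ , refl with Unique-removals r∈ uxs
  ... | y∉ , urest = record { closed = closed ; involutive = involutive ; fixpointFree = fixpointFree }
    where
    module IH = IsPerfectMatchingOn (matchings-sound urest π′∈)
    x∉ = All.All¬⇒¬Any x≢xs
    g = partnerIn ((x , y) ∷ π′)
    gx≡y : g x ≡ y
    gx≡y = partnerIn-head x y π′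
    gy≡x : g y ≡ x
    gy≡x = partnerIn-head′ x y π′ (x≢removed x∉ r∈ y∉ ∘ sym)
    g≡π′ : ∀ {z} → z ∈ rest → g z ≡ partnerIn π′ z
    g≡π′ = partnerIn-remaining x∉ r∈ y∉ π′

    closed : ∀ {z} → z ∈ x ∷ xs → g z ∈ x ∷ xs
    closed z∈ with paired-or-remaining x∉ r∈ y∉ z∈
    ... | inj₁ refl = subst (_∈ x ∷ xs) (sym gx≡y) (there (removed∈ r∈))
    ... | inj₂ (inj₁ refl) = subst (_∈ x ∷ xs) (sym gy≡x) (here refl)
    ... | inj₂ (inj₂ z∈rest) = subst (_∈ x ∷ xs) (sym (g≡π′ z∈rest)) (there (remaining⊆ r∈ (IH.closed z∈rest)))

    involutive : ∀ {z} → z ∈ x ∷ xs → g (g z) ≡ z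
    involutive z∈ with paired-or-remaining x∉ r∈ y∉ z∈
    ... | inj₁ refl = trans (cong g gx≡y) gy≡x
    ... | inj₂ (inj₁ refl) = trans (cong g gy≡x) gx≡y
    ... | inj₂ (inj₂ z∈rest) =
      trans (cong g (g≡π′ z∈rest)) (trans (g≡π′ (IH.closed z∈rest)) (IH.involutive z∈rest))

    fixpointFree : ∀ {z} → z ∈ x ∷ xs → g z ≢ z
    fixpointFree z∈ with paired-or-remaining x∉ r∈ y∉ z∈
    ... | inj₁ refl = x≢removed x∉ r∈ y∉ ∘ sym ∘ trans (sym gx≡y)
    ... | inj₂ (inj₁ refl) = x≢removed x∉ r∈ y∉ ∘ trans (sym gy≡x)
    ... | inj₂ (inj₂ z∈rest) = IH.fixpointFree z∈rest ∘ trans (sym (g≡π′ z∈rest))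

  module _ {x : A} {xs g} (pm : IsPerfectMatchingOn (x ∷ xs) g) where
    open IsPerfectMatchingOn pm

    partner-of-head∈ : g x ∈ xs
    partner-of-head∈ with closed (here refl)
    ... | here gx≡x = ⊥-elim (fixpointFree (here refl) gx≡x)
    ... | there gx∈xs = gx∈xs

  module _ {x : A} {xs g rest} (pm : IsPerfectMatchingOn (x ∷ xs) g)
           (x∉xs : x ∉ xs) (r∈ : (g x , rest) ∈ removals xs) (gx∉rest : g x ∉ rest) where
    open IsPerfectMatchingOn pm

    remaining⊆∷ : ∀ {z} → z ∈ rest → z ∈ x ∷ xs
    remaining⊆∷ = there ∘ remaining⊆ r∈

    -- For z ∈ rest, g z ∈ {x , g x} would give z = g (g z) ∈ {g x , x}.
    IsPerfectMatchingOn-remaining : IsPerfectMatchingOn rest g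
    IsPerfectMatchingOn-remaining = record
      { closed       = closed′
      ; involutive   = involutive ∘ remaining⊆∷
      ; fixpointFree = fixpointFree ∘ remaining⊆∷
      }
      where
      closed′ : ∀ {z} → z ∈ rest → g z ∈ rest
      closed′ {z} z∈ with paired-or-remaining x∉xs r∈ gx∉rest (closed (remaining⊆∷ z∈))
      ... | inj₁ gz≡x = ⊥-elim (gx∉rest (subst (_∈ rest) (trans (sym (involutive (remaining⊆∷ z∈))) (cong g gz≡x)) z∈))
      ... | inj₂ (inj₁ gz≡gx) = ⊥-elim (x∉remaining x∉xs r∈ gx∉rest (subst (_∈ rest)
              (trans (sym (involutive (remaining⊆∷ z∈))) (trans (cong g gz≡gx) (involutive (here refl)))) z∈))
      ... | inj₂ (inj₂ gz∈rest) = gz∈rest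

  matchings-complete : ∀ {f ps g} → Unique ps → IsPerfectMatchingOn ps g → length ps ≤ f →
    ∃[ π ] π ∈ matchings f ps × (∀ {z} → z ∈ ps → partnerIn π z ≡ g z)
  matchings-complete {ps = []} _ _ _ = [] , here refl , λ ()
  matchings-complete {suc f} {x ∷ xs} {g} (x≢xs ∷ uxs) pm (s≤s len≤f) with ∈⇒∈-removals (partner-of-head∈ pm)
  ... | rest , r∈ with Unique-removals r∈ uxs
  ... | gx∉ , urest
    with matchings-complete urest (IsPerfectMatchingOn-remaining pm (All.All¬⇒¬Any x≢xs) r∈ gx∉)
                            (≤-trans (n≤1+n _) (subst (_≤ f) (length-remaining r∈) len≤f))
  ... | π′ , π′∈ , agree = (x , g x) ∷ π′ , ∈-matchings⁺ r∈ π′∈ , agree′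
    where
    open IsPerfectMatchingOn pm
    x∉ = All.All¬⇒¬Any x≢xs
    agree′ : ∀ {z} → z ∈ x ∷ xs → partnerIn ((x , g x) ∷ π′) z ≡ g z
    agree′ z∈ with paired-or-remaining x∉ r∈ gx∉ z∈
    ... | inj₁ refl = partnerIn-head x (g x) π′
    ... | inj₂ (inj₁ refl) =
      trans (partnerIn-head′ x (g x) π′ (fixpointFree (here refl))) (sym (involutive (here refl)))
    ... | inj₂ (inj₂ z∈rest) = trans (partnerIn-remaining x∉ r∈ gx∉ π′ z∈rest) (agree z∈rest)

  DifferOn : List A → Pairing → Pairing → Set
  DifferOn ps π π′ = ¬ (∀ {z} → z ∈ ps → partnerIn π z ≡ partnerIn π′ z)

  matchings-distinct : ∀ {f ps} → Unique ps → AllPairs (DifferOn ps) (matchings f ps)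
  matchings-distinct {ps = []} _ = All.[] ∷ []
  matchings-distinct {zero} {_ ∷ _} _ = []
  matchings-distinct {suc f} {x ∷ xs} (x≢xs ∷ uxs) =
    AllPairs.concat⁺ (All.map⁺ (All.tabulate within))
                     (AllPairs.map⁺ (AllPairs-map (λ {e} {e′} → across {e} {e′}) removals-distinct))
    where
    removals-distinct : AllPairs (λ e e′ → proj₁ e ≢ proj₁ e′) (removals xs)
    removals-distinct = AllPairs.map⁻ (subst Unique (sym (map-proj₁-removals xs)) uxs)

    within : ∀ {e} → e ∈ removals xs → AllPairs (DifferOn (x ∷ xs)) (pairHeadWith f x e)
    within {y , rest} r∈ with Unique-removals r∈ uxs
    ... | y∉ , urest = AllPairs.map⁺ (AllPairs-map lift (matchings-distinct urest))
      where
      same = partnerIn-remaining (All.All¬⇒¬Any x≢xs) r∈ y∉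
      lift : ∀ {π π′} → DifferOn rest π π′ → DifferOn (x ∷ xs) ((x , y) ∷ π) ((x , y) ∷ π′)
      lift {π} {π′} differ agree =
        differ λ z∈ → trans (sym (same π z∈)) (trans (agree (there (remaining⊆ r∈ z∈))) (same π′ z∈))

    across : ∀ {e e′} → proj₁ e ≢ proj₁ e′ →
      All.All (λ π → All.All (DifferOn (x ∷ xs) π) (pairHeadWith f x e′)) (pairHeadWith f x e)
    across {y , rest} {y′ , rest′} y≢y′ = All.tabulate λ π∈ → All.tabulate λ π′∈ → differ π∈ π′∈
      where
      differ : ∀ {π π′} → π ∈ pairHeadWith f x (y , rest) → π′ ∈ pairHeadWith f x (y′ , rest′) → DifferOn (x ∷ xs) π π′
      differ π∈ π′∈ agree with ∈-map⁻ ((x , y) ∷_) π∈ | ∈-map⁻ ((x , y′) ∷_) π′∈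
      ... | a , _ , refl | b , _ , refl =
        y≢y′ (trans (sym (partnerIn-head x y a)) (trans (agree (here refl)) (partnerIn-head x y′ b)))

  matchingCount : ℕ → ℕ → ℕ
  matchingCount _       zero    = 1
  matchingCount zero    (suc _) = 0
  matchingCount (suc f) (suc l) = l * matchingCount f (pred l)

  length-matchings : ∀ f ps → length (matchings f ps) ≡ matchingCount f (length ps)
  length-matchings f [] = refl
  length-matchings zero (x ∷ xs) = refl
  length-matchings (suc f) (x ∷ xs) =
    trans (length-concatMap-const (pairHeadWith f x) (removals xs) (matchingCount f (pred (length xs))) branch)
          (cong (_* matchingCount f (pred (length xs))) (length-removals xs))
    where
    branch : ∀ {e} → e ∈ removals xs → length (pairHeadWith f x e) ≡ matchingCount f (pred (length xs))
    branch {y , rest} r∈ = trans (length-map _ (matchings f rest))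
      (trans (length-matchings f rest) (cong (matchingCount f ∘ pred) (sym (length-remaining r∈))))

-- Matchings with no chord from A to B

m≤n⇒[m∸o]*n≤[n∸o]*m : ∀ {m n} o → m ≤ n → (m ∸ o) * n ≤ (n ∸ o) * m
m≤n⇒[m∸o]*n≤[n∸o]*m {m} {n} o m≤n = begin
  (m ∸ o) * n     ≡⟨ *-distribʳ-∸ n m o ⟩
  m * n ∸ o * n   ≤⟨ ∸-monoʳ-≤ (m * n) (*-monoʳ-≤ o m≤n) ⟩
  m * n ∸ o * m   ≡⟨ cong (_∸ o * m) (*-comm m n) ⟩
  n * m ∸ o * m   ≡⟨ *-distribʳ-∸ m n o ⟨
  (n ∸ o) * m     ∎
  where open ≤-Reasoning

module Avoidance {M : ℕ} (inA inB : Fin M → Bool) where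
  open Matchings {Fin M} _≟_

  avoids : (Fin M → Fin M) → Bool
  avoids g = not (any (λ a → inA a ∧ inB (g a)) (allFin M))

  avoids-cong : ∀ {g h} → (∀ a → inB (g a) ≡ inB (h a)) → avoids g ≡ avoids h
  avoids-cong eq = cong (not ∘ or) (map-cong (λ a → cong (inA a ∧_) (eq a)) (allFin M))

  ¬avoids : ∀ {g} a → T (inA a) → T (inB (g a)) → ¬ T (avoids g)
  ¬avoids {g} a Aa Bga = T⇒¬T-not (any⁺ _ (Any.map (λ { refl → Equivalence.from T-∧ (Aa , Bga) }) (∈-allFin a)))

  ¬avoids⁻ : ∀ {g} → ¬ T (avoids g) → ∃ λ a → T (inA a) × T (inB (g a))
  ¬avoids⁻ ¬av with find (any⁻ _ (allFin M) (¬T-not⇒T ¬av))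
  ... | a , _ , t = a , Equivalence.to T-∧ t

  inB∘partnerIn-cons : ∀ {x y : Fin M} {π : Pairing} → ¬ T (inB x) → ¬ T (inB y) →
    partnerIn π x ≡ x → partnerIn π y ≡ y →
    ∀ a → inB (partnerIn ((x , y) ∷ π) a) ≡ inB (partnerIn π a)
  inB∘partnerIn-cons {x} {y} {π} ¬Bx ¬By πx≡x πy≡y a with a ≟ x | a ≟ y
  ... | yes refl | _       = trans (trans (¬T⇒≡false ¬By) (sym (¬T⇒≡false ¬Bx))) (cong inB (sym πx≡x))
  ... | no _     | yes refl = trans (trans (¬T⇒≡false ¬Bx) (sym (¬T⇒≡false ¬By))) (cong inB (sym πy≡y))
  ... | no _     | no _     = refl

  pairHead-into-B : ∀ {f x y rest} → T (inA x) → T (inB y) →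
    count (avoids ∘ partnerIn) (pairHeadWith f x (y , rest)) ≡ 0
  pairHead-into-B {f} {x} {y} {rest} Ax By = count-none (pairHeadWith f x (y , rest)) λ π∈ → ¬ok π∈
    where
    ¬ok : ∀ {π} → π ∈ pairHeadWith f x (y , rest) → ¬ T (avoids (partnerIn π))
    ¬ok π∈ with ∈-map⁻ ((x , y) ∷_) π∈
    ... | π′ , _ , refl = ¬avoids x Ax (subst (T ∘ inB) (sym (partnerIn-head x y π′)) By)

  pairHead-outside-B : ∀ {f x y xs rest} → x ∉ xs → (y , rest) ∈ removals xs → y ∉ rest →
    ¬ T (inB x) → ¬ T (inB y) →
    count (avoids ∘ partnerIn) (pairHeadWith f x (y , rest)) ≡ count (avoids ∘ partnerIn) (matchings f rest)
  pairHead-outside-B {f} {x} {y} {xs} {rest} x∉xs r∈ y∉ ¬Bx ¬By =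
    trans (count-map (avoids ∘ partnerIn) ((x , y) ∷_) (matchings f rest)) (count-cong (matchings f rest) λ π∈ →
      avoids-cong (inB∘partnerIn-cons ¬Bx ¬By (matchings-fix-outside π∈ (x∉remaining x∉xs r∈ y∉))
                                              (matchings-fix-outside π∈ y∉)))

  partners-outside-B : ∀ {r xs} → r ≤ count inB xs → count (not ∘ inB ∘ proj₁) (removals xs) ≤ length xs ∸ r
  partners-outside-B {r} {xs} r≤B = begin
    count (not ∘ inB ∘ proj₁) (removals xs)            ≡⟨ count-map (not ∘ inB) proj₁ (removals xs) ⟨
    count (not ∘ inB) (map proj₁ (removals xs))        ≡⟨ cong (count (not ∘ inB)) (map-proj₁-removals xs) ⟩
    count (not ∘ inB) xs                               ≡⟨ m+n∸m≡n (count inB xs) _ ⟨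
    count inB xs + count (not ∘ inB) xs ∸ count inB xs ≡⟨ cong (_∸ count inB xs) (count-complement inB xs) ⟩
    length xs ∸ count inB xs                           ≤⟨ ∸-monoʳ-≤ (length xs) r≤B ⟩
    length xs ∸ r                                      ∎
    where open ≤-Reasoning

  -- Each step pairs the current first point, which lies in A, and uses up at most two points of A;
  -- at most N partners are available to it, and the r or more points of B are forbidden.
  avoidance-bound : (∀ {z} → T (inA z) → ¬ T (inB z)) → ∀ N r f ps s → Unique ps → AllFirst inA (s + s) ps →
    r ≤ count inB ps → length ps ≤ suc N →
    count (avoids ∘ partnerIn) (matchings f ps) * N ^ s ≤ (N ∸ r) ^ s * matchingCount f (length ps)
  avoidance-bound _ N r f ps zero _ _ _ _ = begin
    count (avoids ∘ partnerIn) (matchings f ps) * 1 ≡⟨ *-identityʳ _ ⟩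
    count (avoids ∘ partnerIn) (matchings f ps)     ≤⟨ count≤length _ (matchings f ps) ⟩
    length (matchings f ps)                         ≡⟨ length-matchings f ps ⟩
    matchingCount f (length ps)                     ≡⟨ +-identityʳ _ ⟨
    1 * matchingCount f (length ps)                 ∎
    where open ≤-Reasoning
  avoidance-bound _ N r f [] (suc s) _ () _ _
  avoidance-bound _ N r zero (x ∷ xs) (suc s) _ _ _ _ = z≤n
  avoidance-bound A∩B≡∅ N r (suc f) (x ∷ xs) (suc s) (x≢xs ∷ uxs) (Ax , first) r≤Bxxs (s≤s l≤N) = begin
    count ok (concatMap (pairHeadWith f x) (removals xs)) * N ^ suc s
      ≡⟨ cong (_* N ^ suc s) (count-concatMap ok (pairHeadWith f x) (removals xs)) ⟩
    sum (map h (removals xs)) * (N * N ^ s)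
      ≡⟨ x∙yz≈y∙xz (sum (map h (removals xs))) N (N ^ s) ⟩
    N * (sum (map h (removals xs)) * N ^ s)
      ≤⟨ *-monoʳ-≤ N (sum-≤-count (not ∘ inB ∘ proj₁) h (N ^ s) X (removals xs) into-B outside-B) ⟩
    N * (count (not ∘ inB ∘ proj₁) (removals xs) * X)
      ≤⟨ *-monoʳ-≤ N (*-monoˡ-≤ X (partners-outside-B {r} {xs} r≤Bxs)) ⟩
    N * ((l ∸ r) * X)
      ≡⟨ x∙yz≈yx∙z N (l ∸ r) X ⟩
    ((l ∸ r) * N) * X
      ≤⟨ *-monoˡ-≤ X (m≤n⇒[m∸o]*n≤[n∸o]*m r l≤N) ⟩
    ((N ∸ r) * l) * ((N ∸ r) ^ s * C)
      ≡⟨ interchange (N ∸ r) l ((N ∸ r) ^ s) C ⟩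
    (N ∸ r) ^ suc s * (l * C) ∎
    where
    open ≤-Reasoning
    ok = avoids ∘ partnerIn
    l = length xs
    C = matchingCount f (pred l)
    X = (N ∸ r) ^ s * C
    h = count ok ∘ pairHeadWith f x
    ¬Bx = A∩B≡∅ Ax
    r≤Bxs : r ≤ count inB xs
    r≤Bxs = subst (r ≤_) (count-∷-reject xs ¬Bx) r≤Bxxs

    into-B : ∀ {e} → e ∈ removals xs → ¬ T (not (inB (proj₁ e))) → h e ≡ 0
    into-B {y , rest} _ ¬¬By = pairHead-into-B {f} {rest = rest} Ax (¬T-not⇒T ¬¬By)

    outside-B : ∀ {e} → e ∈ removals xs → T (not (inB (proj₁ e))) → h e * N ^ s ≤ X
    outside-B {y , rest} r∈ ¬By′ with Unique-removals r∈ uxs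
    ... | y∉ , urest = begin
      h (y , rest) * N ^ s
        ≡⟨ cong (_* N ^ s) (pairHead-outside-B (All.All¬⇒¬Any x≢xs) r∈ y∉ ¬Bx ¬By) ⟩
      count ok (matchings f rest) * N ^ s
        ≤⟨ avoidance-bound A∩B≡∅ N r f rest s urest first-rest r≤Brest len≤ ⟩
      (N ∸ r) ^ s * matchingCount f (length rest)
        ≡⟨ cong (λ k → (N ∸ r) ^ s * matchingCount f (pred k)) (length-remaining r∈) ⟨
      X ∎
      where
      ¬By = T-not⇒¬T ¬By′
      first-rest = AllFirst-removals inA (s + s) (subst (λ k → AllFirst inA k xs) (+-suc s s) first) r∈
      r≤Brest : r ≤ count inB rest
      r≤Brest = subst (r ≤_) (trans (count-↭ inB (removals-↭ r∈)) (count-∷-reject rest ¬By)) r≤Bxs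
      len≤ : length rest ≤ suc N
      len≤ = ≤-trans (≤-trans (n≤1+n _) (subst (_≤ N) (length-remaining r∈) l≤N)) (n≤1+n N)

-- The exponential series against the negative binomial series

^-distribʳ-* : ∀ m n k → (m * n) ^ k ≡ m ^ k * n ^ k
^-distribʳ-* m n zero = refl
^-distribʳ-* m n (suc k) = trans (cong (m * n *_) (^-distribʳ-* m n k)) (interchange m n (m ^ k) (n ^ k))

rising : ℕ → ℕ → ℕ
rising t zero    = 1
rising t (suc j) = rising t j * (t + j)

rising-suc : ∀ t k → rising t (suc k) ≡ t * rising (suc t) k
rising-suc t zero = trans (*-identityˡ (t + 0)) (trans (+-identityʳ t) (sym (*-identityʳ t)))
rising-suc t (suc k) = begin
  rising t (suc k) * (t + suc k)       ≡⟨ cong₂ _*_ (rising-suc t k) (+-suc t k) ⟩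
  t * rising (suc t) k * suc (t + k)   ≡⟨ *-assoc t _ _ ⟩
  t * (rising (suc t) k * suc (t + k)) ∎
  where open ≡-Reasoning

^≤rising : ∀ t j → t ^ j ≤ rising t j
^≤rising t zero = ≤-refl
^≤rising t (suc j) = subst (_≤ rising t j * (t + j)) (*-comm (t ^ j) t) (*-mono-≤ (^≤rising t j) (m≤m+n t j))

module NegativeBinomial (u r : ℕ) where

  N : ℕ
  N = u + r

  -- k! Nᵏ · Σ_{j ≤ k} rising t j xʲ / j!  for x = r / N: a truncation of (1 - x)⁻ᵗ.
  series : ℕ → ℕ → ℕ
  series t zero    = 1
  series t (suc k) = suc k * (N * series t k) + rising t (suc k) * r ^ suc k

  -- Pascal's rule for the coefficients, i.e. (1 - x) (1 - x)^-(t+1) = (1 - x)^-t up to the truncation term.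
  series-step : ∀ t k → u * series (suc t) k + rising (suc t) k * r ^ suc k ≡ N * series t k
  series-step t zero = unit u r
    where
    unit : ∀ u r → u * 1 + 1 * (r * 1) ≡ (u + r) * 1
    unit = solve-∀
  series-step t (suc k) = begin
    u * (suc k * (N * g) + (ρ * (suc t + k)) * rk) + (ρ * (suc t + k)) * (r * rk)
      ≡⟨ expand u r k g ρ rk t ⟩
    suc k * (N * (u * g + ρ * rk)) + N * (t * ρ * rk)
      ≡⟨ cong₂ (λ a b → suc k * (N * a) + N * (b * rk)) (series-step t k) (sym (rising-suc t k)) ⟩
    suc k * (N * (N * series t k)) + N * (rising t (suc k) * rk)
      ≡⟨ factor k N (series t k) (rising t (suc k)) rk ⟩
    N * series t (suc k) ∎
    where
    open ≡-Reasoning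
    g  = series (suc t) k
    ρ  = rising (suc t) k
    rk = r ^ suc k
    expand : ∀ u r k g ρ rk t → u * (suc k * ((u + r) * g) + (ρ * (suc t + k)) * rk) + (ρ * (suc t + k)) * (r * rk)
                              ≡ suc k * ((u + r) * (u * g + ρ * rk)) + (u + r) * (t * ρ * rk)
    expand = solve-∀
    factor : ∀ k N s ρ rk → suc k * (N * (N * s)) + N * (ρ * rk) ≡ N * (suc k * (N * s) + ρ * rk)
    factor = solve-∀

  series-zero : ∀ k → series 0 k ≡ k ! * N ^ k
  series-zero zero = refl
  series-zero (suc k) = begin
    suc k * (N * series 0 k) + rising 0 (suc k) * r ^ suc k
      ≡⟨ cong₂ (λ a b → suc k * (N * a) + b * r ^ suc k) (series-zero k) (rising-suc 0 k) ⟩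
    suc k * (N * (k ! * N ^ k)) + 0 * r ^ suc k
      ≡⟨ regroup k N (k !) (N ^ k) (r ^ suc k) ⟩
    suc k * k ! * (N * N ^ k) ∎
    where
    open ≡-Reasoning
    regroup : ∀ k N f p q → suc k * (N * (f * p)) + 0 * q ≡ suc k * f * (N * p)
    regroup = solve-∀

  series-bound : ∀ t k → u ^ t * series t k ≤ N ^ t * (k ! * N ^ k)
  series-bound zero k = ≤-reflexive (cong (1 *_) (series-zero k))
  series-bound (suc t) k = begin
    u * u ^ t * series (suc t) k                            ≡⟨ x∙yz≈y∙xz′ ⟩
    u ^ t * (u * series (suc t) k)                          ≤⟨ *-monoʳ-≤ (u ^ t) (m≤m+n _ _) ⟩
    u ^ t * (u * series (suc t) k + rising (suc t) k * r ^ suc k) ≡⟨ cong (u ^ t *_) (series-step t k) ⟩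
    u ^ t * (N * series t k)                                ≡⟨ x∙yz≈y∙xz (u ^ t) N (series t k) ⟩
    N * (u ^ t * series t k)                                ≤⟨ *-monoʳ-≤ N (series-bound t k) ⟩
    N * (N ^ t * (k ! * N ^ k))                             ≡⟨ *-assoc N (N ^ t) _ ⟨
    N * N ^ t * (k ! * N ^ k)                               ∎
    where
    open ≤-Reasoning
    x∙yz≈y∙xz′ = trans (*-assoc u (u ^ t) _) (x∙yz≈y∙xz u (u ^ t) (series (suc t) k))

  expPartial≤series : ∀ {P t} → P * N ≤ t * r → ∀ k → expPartial P k * N ^ k ≤ series t k
  expPartial≤series h zero = ≤-refl
  expPartial≤series {P} {t} h (suc k) = begin
    (suc k * expPartial P k + P ^ suc k) * (N * N ^ k)
      ≡⟨ distribute k (expPartial P k) (P ^ suc k) N (N ^ k) ⟩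
    suc k * (N * (expPartial P k * N ^ k)) + P ^ suc k * N ^ suc k
      ≤⟨ +-mono-≤ (*-monoʳ-≤ (suc k) (*-monoʳ-≤ N (expPartial≤series h k))) last-term ⟩
    suc k * (N * series t k) + rising t (suc k) * r ^ suc k ∎
    where
    open ≤-Reasoning
    distribute : ∀ k e p n q → (suc k * e + p) * (n * q) ≡ suc k * (n * (e * q)) + p * (n * q)
    distribute = solve-∀
    last-term : P ^ suc k * N ^ suc k ≤ rising t (suc k) * r ^ suc k
    last-term = begin
      P ^ suc k * N ^ suc k   ≡⟨ ^-distribʳ-* P N (suc k) ⟨
      (P * N) ^ suc k         ≤⟨ ^-monoˡ-≤ (suc k) h ⟩
      (t * r) ^ suc k         ≡⟨ ^-distribʳ-* t r (suc k) ⟩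
      t ^ suc k * r ^ suc k   ≤⟨ *-monoˡ-≤ (r ^ suc k) (^≤rising t (suc k)) ⟩
      rising t (suc k) * r ^ suc k ∎

-- e^P ≤ e^(t r / N) ≤ (1 - r/N)⁻ᵗ = (N / u)ᵗ, compared through the truncated series above.
ExpAtLeast⇒*^≤^ : ∀ {P M} u r t → .{{NonZero (u + r)}} → P * (u + r) ≤ t * r → ExpAtLeast P M →
  M * u ^ t ≤ (u + r) ^ t
ExpAtLeast⇒*^≤^ {P} {M} u r t h (k , M*k!≤) =
  *-cancelʳ-≤ (M * u ^ t) (N ^ t) (k ! * N ^ k) {{m*n≢0 (k !) (N ^ k) {{k !≢0}} {{m^n≢0 N k}}}} (begin
    M * u ^ t * (k ! * N ^ k)       ≡⟨ regroup M (u ^ t) (k !) (N ^ k) ⟩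
    u ^ t * (M * k ! * N ^ k)       ≤⟨ *-monoʳ-≤ (u ^ t) (*-monoˡ-≤ (N ^ k) M*k!≤) ⟩
    u ^ t * (expPartial P k * N ^ k) ≤⟨ *-monoʳ-≤ (u ^ t) (expPartial≤series h k) ⟩
    u ^ t * series t k              ≤⟨ series-bound t k ⟩
    N ^ t * (k ! * N ^ k)           ∎)
  where
  open NegativeBinomial u r
  open ≤-Reasoning
  regroup : ∀ m a f n → m * a * (f * n) ≡ a * (m * f * n)
  regroup = solve-∀

-- The case u = r = 1 of the previous lemma: n^K ≤ e^P ≤ 4^P.
ExpAtLeast-^⇒exponent≤ : ∀ {P n K} → 2 ≤ n → ExpAtLeast P (n ^ K) → K ≤ 2 * P
ExpAtLeast-^⇒exponent≤ {P} {n} {K} 2≤n h with K ≤? 2 * P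
... | yes K≤2P = K≤2P
... | no K≰2P = contradiction n^K≤2^2P (<⇒≱ (begin-strict
    2 ^ (2 * P) <⟨ ^-monoʳ-< 2 ≤-refl (≰⇒> K≰2P) ⟩
    2 ^ K       ≤⟨ ^-monoˡ-≤ K 2≤n ⟩
    n ^ K       ∎))
  where
  open ≤-Reasoning
  P*2≤2P*1 : P * 2 ≤ 2 * P * 1
  P*2≤2P*1 = ≤-reflexive (trans (*-comm P 2) (sym (*-identityʳ (2 * P))))
  n^K≤2^2P : n ^ K ≤ 2 ^ (2 * P)
  n^K≤2^2P = begin
    n ^ K                 ≡⟨ *-identityʳ (n ^ K) ⟨
    n ^ K * 1             ≡⟨ cong (n ^ K *_) (^-zeroˡ (2 * P)) ⟨
    n ^ K * 1 ^ (2 * P)   ≤⟨ ExpAtLeast⇒*^≤^ {M = n ^ K} 1 1 (2 * P) P*2≤2P*1 h ⟩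
    2 ^ (2 * P)           ∎

-- Consequences of the hypothesis on m

^-cancelʳ-≤ : ∀ k .{{_ : NonZero k}} {m n} → m ^ k ≤ n ^ k → m ≤ n
^-cancelʳ-≤ k {m} {n} h with m ≤? n
... | yes m≤n = m≤n
... | no m≰n = contradiction h (<⇒≱ (^-monoˡ-< k (≰⇒> m≰n)))

m*m≤n*n⇒m≤n : ∀ {m n} → m * m ≤ n * n → m ≤ n
m*m≤n*n⇒m≤n {m} {n} = ^-cancelʳ-≤ 2 ∘ subst₂ _≤_ (square m) (square n)
  where
  square : ∀ x → x * x ≡ x ^ 2
  square x = cong (x *_) (sym (*-identityʳ x))

m<suc[m/n]*n : ∀ m n .{{_ : NonZero n}} → m < suc (m / n) * n
m<suc[m/n]*n m n = begin-strict
  m                      ≡⟨ m≡m%n+[m/n]*n m n ⟩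
  m % n + (m / n) * n    <⟨ +-monoˡ-< ((m / n) * n) (m%n<n m n) ⟩
  n + (m / n) * n        ∎
  where open ≤-Reasoning

squareOf2b+a : ℕ → ℕ → ℕ
squareOf2b+a a b = (2 * b + a) * (2 * b + a)

-- Large enough that q m ≤ n and 8 (2b + a)² m ≤ n follow from m² ≤ n.
threshold : ℕ → ℕ → ℕ → ℕ
threshold a b q = 8 * squareOf2b+a a b * (8 * squareOf2b+a a b) + q * q + 2

module Estimates (a b q n m : ℕ) .{{_ : NonZero a}} .{{_ : NonZero b}} .{{_ : NonZero m}}
  (large : threshold a b q ≤ n) (bound : MBound a b n m) where

  C K P N r s u : ℕ
  C = squareOf2b+a a b
  K = m * m * C
  P = n * (b * b)
  N = 2 * n ∸ 1
  r = n / m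
  s = r / 2
  u = N ∸ r

  2≤n : 2 ≤ n
  2≤n = ≤-trans (m≤n+m 2 _) large

  q*q≤n : q * q ≤ n
  q*q≤n = ≤-trans (≤-trans (m≤n+m (q * q) _) (m≤m+n _ 2)) large

  8C*8C≤n : 8 * C * (8 * C) ≤ n
  8C*8C≤n = ≤-trans (≤-trans (m≤m+n _ (q * q)) (m≤m+n _ 2)) large

  4b²+1≤C : 4 * (b * b) + 1 ≤ C
  4b²+1≤C = begin
    4 * (b * b) + 1                    ≤⟨ +-monoʳ-≤ (4 * (b * b)) 1≤4ab+aa ⟩
    4 * (b * b) + (4 * a * b + a * a)  ≡⟨ expand a b ⟩
    C                                  ∎
    where
    open ≤-Reasoning
    1≤4ab+aa = ≤-trans (*-mono-≤ (>-nonZero⁻¹ a) (>-nonZero⁻¹ a)) (m≤n+m (a * a) (4 * a * b))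
    expand : ∀ a b → 4 * (b * b) + (4 * a * b + a * a) ≡ (2 * b + a) * (2 * b + a)
    expand = solve-∀

  m*m≤n : m * m ≤ n
  m*m≤n = *-cancelʳ-≤ (m * m) n (2 * (b * b)) {{m*n≢0 2 (b * b) {{_}} {{m*n≢0 b b}}}} (begin
    m * m * (2 * (b * b))  ≤⟨ *-monoʳ-≤ (m * m) 2b²≤C ⟩
    K                      ≤⟨ ExpAtLeast-^⇒exponent≤ 2≤n bound ⟩
    2 * (n * (b * b))      ≡⟨ x∙yz≈y∙xz 2 n (b * b) ⟩
    n * (2 * (b * b))      ∎)
    where
    open ≤-Reasoning
    2b²≤C : 2 * (b * b) ≤ C
    2b²≤C = ≤-trans (*-monoˡ-≤ (b * b) (≤-trans (n≤1+n 2) (n≤1+n 3))) (≤-trans (m≤m+n _ 1) 4b²+1≤C)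

  q*m≤n : q * m ≤ n
  q*m≤n = m*m≤n*n⇒m≤n (subst (_≤ n * n) (interchange q q m m) (*-mono-≤ q*q≤n m*m≤n))

  8C*m≤n : 8 * C * m ≤ n
  8C*m≤n = m*m≤n*n⇒m≤n (subst (_≤ n * n) (interchange (8 * C) (8 * C) m m) (*-mono-≤ 8C*8C≤n m*m≤n))

  m≤n : m ≤ n
  m≤n = ≤-trans (m≤m*n m m) m*m≤n

  r*m≤n : r * m ≤ n
  r*m≤n = m/n*n≤m n m

  s+s≤r : s + s ≤ r
  s+s≤r = subst (_≤ r) (trans (*-comm s 2) (cong (s +_) (+-identityʳ s))) (m/n*n≤m r 2)

  1≤n : 1 ≤ n
  1≤n = ≤-trans (n≤1+n 1) 2≤n

  suc[N]≡2n : suc N ≡ 2 * n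
  suc[N]≡2n = trans (+-comm 1 N) (m∸n+n≡m (≤-trans 1≤n (m≤m+n n (n + 0))))

  r≤N : r ≤ N
  r≤N = ≤-trans (m/n≤m n m) (s≤s⁻¹ (subst (n <_) (sym suc[N]≡2n) (m<m+n n (≤-trans 1≤n (m≤m+n n 0)))))

  1≤N : 1 ≤ N
  1≤N = s≤s⁻¹ (subst (2 ≤_) (sym suc[N]≡2n) (≤-trans 2≤n (m≤m+n n _)))

  u+r≡N : u + r ≡ N
  u+r≡N = m∸n+n≡m r≤N

  Y : ℕ
  Y = s * 2 * m

  Y≤n : Y ≤ n
  Y≤n = ≤-trans (*-monoˡ-≤ m (m/n*n≤m r 2)) r*m≤n

  n≤Y+2m : n ≤ Y + 2 * m
  n≤Y+2m = begin
    n              ≤⟨ <⇒≤ (m<suc[m/n]*n n m) ⟩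
    suc r * m      ≤⟨ *-monoˡ-≤ m (m<suc[m/n]*n r 2) ⟩
    suc s * 2 * m  ≡⟨ split s m ⟩
    Y + 2 * m      ∎
    where
    open ≤-Reasoning
    split : ∀ s m → suc s * 2 * m ≡ s * 2 * m + 2 * m
    split = solve-∀

  4b²n²≤CY² : 4 * (b * b) * (n * n) ≤ C * (Y * Y)
  4b²n²≤CY² = +-cancelʳ-≤ (8 * C * m * n) _ _ (begin
    4 * (b * b) * (n * n) + 8 * C * m * n        ≤⟨ +-monoʳ-≤ (4 * (b * b) * (n * n)) (*-monoˡ-≤ n 8C*m≤n) ⟩
    4 * (b * b) * (n * n) + n * n                ≡⟨ factor (4 * (b * b)) (n * n) ⟩
    (4 * (b * b) + 1) * (n * n)                  ≤⟨ *-mono-≤ 4b²+1≤C (*-mono-≤ n≤Y+2m n≤Y+2m) ⟩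
    C * ((Y + 2 * m) * (Y + 2 * m))              ≡⟨ expand C Y m ⟩
    C * (Y * Y) + 4 * C * m * Y + 4 * C * m * m  ≤⟨ +-mono-≤ (+-monoʳ-≤ (C * (Y * Y)) (*-monoʳ-≤ (4 * C * m) Y≤n))
                                                                (*-monoʳ-≤ (4 * C * m) m≤n) ⟩
    C * (Y * Y) + 4 * C * m * n + 4 * C * m * n  ≡⟨ collect (C * (Y * Y)) C m n ⟩
    C * (Y * Y) + 8 * C * m * n                  ∎)
    where
    open ≤-Reasoning
    factor : ∀ x z → x * z + z ≡ (x + 1) * z
    factor = solve-∀
    expand : ∀ C Y m → C * ((Y + 2 * m) * (Y + 2 * m)) ≡ C * (Y * Y) + 4 * C * m * Y + 4 * C * m * m
    expand = solve-∀
    collect : ∀ A C m n → A + 4 * C * m * n + 4 * C * m * n ≡ A + 8 * C * m * n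
    collect = solve-∀

  -- The slack ε > 0 enters through 4b² + 1 ≤ (2b + a)².
  P*N≤K*s*r : P * N ≤ K * s * r
  P*N≤K*s*r = *-cancelˡ-≤ 2 (begin
    2 * (P * N)                  ≤⟨ *-monoʳ-≤ 2 (*-monoʳ-≤ P (m∸n≤m (2 * n) 1)) ⟩
    2 * (n * (b * b) * (2 * n))  ≡⟨ square n (b * b) ⟩
    4 * (b * b) * (n * n)        ≤⟨ 4b²n²≤CY² ⟩
    C * (Y * Y)                  ≤⟨ *-monoʳ-≤ C (*-monoʳ-≤ Y (*-monoˡ-≤ m (m/n*n≤m r 2))) ⟩
    C * (Y * (r * m))            ≡⟨ regroup C s m r ⟩
    2 * (K * s * r)              ∎)
    where
    open ≤-Reasoning
    square : ∀ n x → 2 * (n * x * (2 * n)) ≡ 4 * x * (n * n)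
    square = solve-∀
    regroup : ∀ C s m r → C * (s * 2 * m * (r * m)) ≡ 2 * (m * m * C * s * r)
    regroup = solve-∀

  instance
    N≢0 : NonZero N
    N≢0 = >-nonZero 1≤N

  K≢0 : NonZero K
  K≢0 = m*n≢0 (m * m) C {{m*n≢0 m m}} {{>-nonZero (≤-trans (m≤n+m 1 _) 4b²+1≤C)}}

  n*u^s≤N^s : n * u ^ s ≤ N ^ s
  n*u^s≤N^s = ^-cancelʳ-≤ K {{K≢0}} (begin
    (n * u ^ s) ^ K       ≡⟨ ^-distribʳ-* n (u ^ s) K ⟩
    n ^ K * (u ^ s) ^ K   ≡⟨ cong (n ^ K *_) (trans (^-*-assoc u s K) (cong (u ^_) (*-comm s K))) ⟩
    n ^ K * u ^ (K * s)   ≤⟨ subst (λ x → n ^ K * u ^ (K * s) ≤ x ^ (K * s)) u+r≡N exp-bound ⟩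
    N ^ (K * s)           ≡⟨ trans (cong (N ^_) (*-comm K s)) (sym (^-*-assoc N s K)) ⟩
    (N ^ s) ^ K           ∎)
    where
    open ≤-Reasoning
    exp-bound : n ^ K * u ^ (K * s) ≤ (u + r) ^ (K * s)
    exp-bound = ExpAtLeast⇒*^≤^ {P} {n ^ K} u r (K * s) {{subst NonZero (sym u+r≡N) N≢0}}
                  (subst (λ x → P * x ≤ K * s * r) (sym u+r≡N) P*N≤K*s*r) bound

  q*m*u^s≤N^s : q * m * u ^ s ≤ N ^ s
  q*m*u^s≤N^s = ≤-trans (*-monoˡ-≤ (u ^ s) q*m≤n) n*u^s≤N^s

-- Blocks and balanced cliques

count-tabulate-suc : ∀ {M} (p : Fin (suc M) → Bool) → count p (List.tabulate Fin.suc) ≡ count (p ∘ Fin.suc) (allFin M)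
count-tabulate-suc {M} p =
  trans (cong (count p) (sym (map-tabulate (λ z → z) Fin.suc))) (count-map p Fin.suc (allFin M))

-- Tests lo < 1 + z rather than lo ≤ z so that both comparisons compute under suc.
inInterval : ∀ {M} → ℕ → ℕ → Fin M → Bool
inInterval lo hi z = (toℕ z <ᵇ hi) ∧ (lo <ᵇ suc (toℕ z))

count-interval : ∀ {M} lo hi → hi ≤ M → count (inInterval lo hi) (allFin M) ≡ hi ∸ lo
count-interval {zero} lo zero z≤n = sym (0∸n≡0 lo)
count-interval {suc M} lo zero _ =
  trans (count-none {p = inInterval lo 0} (allFin (suc M)) λ { {zero} _ () ; {suc _} _ () }) (sym (0∸n≡0 lo))
count-interval {suc M} zero (suc hi) (s≤s hi≤M) =
  cong suc (trans (count-tabulate-suc {M} (inInterval 0 (suc hi))) (count-interval zero hi hi≤M))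
count-interval {suc M} (suc lo) (suc hi) (s≤s hi≤M) =
  trans (count-tabulate-suc {M} (inInterval (suc lo) (suc hi))) (count-interval lo hi hi≤M)

module BlockStructure (n m : ℕ) .{{_ : NonZero m}} where

  r : ℕ
  r = blockLen n m

  inBlock : ℕ → Fin (2 * n) → Bool
  inBlock j = inInterval (j * r) (suc j * r)

  inBlock-sound : ∀ {j x} → T (inBlock j x) → InBlock n m j x
  inBlock-sound {j} {x} t with Equivalence.to T-∧ t
  ... | x< , lo< = s≤s⁻¹ (<ᵇ⇒< (j * r) (suc (toℕ x)) lo<) , <ᵇ⇒< (toℕ x) (suc j * r) x<

  InBlock-< : ∀ {j j′ x x′} → InBlock n m j x → InBlock n m j′ x′ → j < j′ → toℕ x < toℕ x′
  InBlock-< (_ , x<) (lo′≤ , _) j<j′ = <-≤-trans x< (≤-trans (*-monoˡ-≤ r j<j′) lo′≤)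

  InBlock-unique : ∀ {j j′ x} → InBlock n m j x → InBlock n m j′ x → j ≡ j′
  InBlock-unique {j} {j′} b b′ with <-cmp j j′
  ... | tri< j<j′ _ _ = ⊥-elim (<-irrefl refl (InBlock-< b b′ j<j′))
  ... | tri≈ _ j≡j′ _ = j≡j′
  ... | tri> _ _ j>j′ = ⊥-elim (<-irrefl refl (InBlock-< b′ b j>j′))

  i<m+i : ∀ i → i < m + i
  i<m+i i = m<n+m i (>-nonZero⁻¹ m)

  count-inBlock : ∀ j → suc j * r ≤ 2 * n → count (inBlock j) (allFin (2 * n)) ≡ r
  count-inBlock j h = trans (count-interval (j * r) (suc j * r) h) (m+n∸n≡m r (j * r))

tail-disjoint : ∀ {k a b} {p q : Subset k} → (∀ {x} → x ∈ₛ a ∷ p → x ∉ₛ b ∷ q) → ∀ {x} → x ∈ₛ p → x ∉ₛ q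
tail-disjoint disjoint x∈p x∈q = disjoint (there x∈p) (there x∈q)

∣p∪q∣≡∣p∣+∣q∣ : ∀ {k} (p q : Subset k) → (∀ {x} → x ∈ₛ p → x ∉ₛ q) → ∣ p ∪ q ∣ ≡ ∣ p ∣ + ∣ q ∣
∣p∪q∣≡∣p∣+∣q∣ []            []            _ = refl
∣p∪q∣≡∣p∣+∣q∣ (true ∷ p)    (true ∷ q)    disjoint = ⊥-elim (disjoint here here)
∣p∪q∣≡∣p∣+∣q∣ (true ∷ p)    (false ∷ q)   disjoint = cong suc (∣p∪q∣≡∣p∣+∣q∣ p q (tail-disjoint disjoint))
∣p∪q∣≡∣p∣+∣q∣ (false ∷ p)   (true ∷ q)    disjoint =
  trans (cong suc (∣p∪q∣≡∣p∣+∣q∣ p q (tail-disjoint disjoint))) (sym (+-suc _ _))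
∣p∪q∣≡∣p∣+∣q∣ (false ∷ p)   (false ∷ q)   disjoint = ∣p∪q∣≡∣p∣+∣q∣ p q (tail-disjoint disjoint)

<m+m⇒<m⊎≡m+ : ∀ {j m} → j < m + m → j < m ⊎ ∃ λ i → i < m × j ≡ m + i
<m+m⇒<m⊎≡m+ {j} {m} j<m+m with j <? m
... | yes j<m = inj₁ j<m
... | no j≮m = inj₂ (j ∸ m , +-cancelˡ-< m (j ∸ m) m (subst (_< m + m) (sym j≡) j<m+m) , sym j≡)
  where j≡ = m+[n∸m]≡n (≮⇒≥ j≮m)

Interleave-sym : ∀ {a b c e} → Interleave a b c e → Interleave c e a b
Interleave-sym (inj₁ h) = inj₂ h
Interleave-sym (inj₂ h) = inj₁ h

module Clique (n m : ℕ) .{{_ : NonZero m}} (D : Diagram n) (isCD : IsChordDiagram n D) (w : ℕ → Fin (2 * n))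
  (w-blocks : ∀ {i} → i < m → InBlock n m i (w i) × InBlock n m (m + i) (partner n D (w i))) where
  open BlockStructure n m

  d : Fin (2 * n) → Fin (2 * n)
  d = partner n D

  OnChord : ℕ → Fin (2 * n) → Set
  OnChord i x = x ≡ w i ⊎ x ≡ d (w i)

  OnChord-partner : ∀ {i x} → OnChord i x → OnChord i (d x)
  OnChord-partner (inj₁ refl) = inj₂ refl
  OnChord-partner (inj₂ refl) = inj₁ (proj₁ (isCD _))

  OnChord-same : ∀ {i x y} → OnChord i x → OnChord i y → y ≡ x ⊎ y ≡ d x
  OnChord-same (inj₁ refl) (inj₁ refl) = inj₁ refl
  OnChord-same (inj₁ refl) (inj₂ refl) = inj₂ refl
  OnChord-same (inj₂ refl) (inj₁ refl) = inj₂ (sym (proj₁ (isCD _)))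
  OnChord-same (inj₂ refl) (inj₂ refl) = inj₁ refl

  OnChord-block : ∀ {i x} → i < m → OnChord i x → ∃ λ b → InBlock n m b x × (b ≡ i ⊎ b ≡ m + i)
  OnChord-block {i} i<m (inj₁ refl) = i , proj₁ (w-blocks i<m) , inj₁ refl
  OnChord-block {i} i<m (inj₂ refl) = m + i , proj₂ (w-blocks i<m) , inj₂ refl

  OnChord-unique : ∀ {i i′ x} → i < m → i′ < m → OnChord i x → OnChord i′ x → i ≡ i′
  OnChord-unique i<m i′<m c c′ with OnChord-block i<m c | OnChord-block i′<m c′
  ... | b , x∈b , b≡ | b′ , x∈b′ , b′≡ =
    same-index i<m i′<m (subst (λ k → k ≡ _ ⊎ k ≡ _) (InBlock-unique x∈b x∈b′) b≡) b′≡
    where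
    same-index : ∀ {i i′ b} → i < m → i′ < m → b ≡ i ⊎ b ≡ m + i → b ≡ i′ ⊎ b ≡ m + i′ → i ≡ i′
    same-index _   _    (inj₁ refl) (inj₁ refl) = refl
    same-index i<m _    (inj₁ refl) (inj₂ refl) = ⊥-elim (<⇒≱ i<m (m≤m+n m _))
    same-index _   i′<m (inj₂ refl) (inj₁ refl) = ⊥-elim (<⇒≱ i′<m (m≤m+n m _))
    same-index _   _    (inj₂ refl) (inj₂ eq)   = +-cancelˡ-≡ m _ _ eq

  chords : ℕ → Subset (2 * n)
  chords zero    = ∅
  chords (suc k) = (⁅ w k ⁆ ∪ ⁅ d (w k) ⁆) ∪ chords k

  ∈-chords⁻ : ∀ {k x} → x ∈ₛ chords k → ∃ λ i → i < k × OnChord i x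
  ∈-chords⁻ {zero} x∈ = ⊥-elim (∉⊥ x∈)
  ∈-chords⁻ {suc k} x∈ with x∈p∪q⁻ (⁅ w k ⁆ ∪ ⁅ d (w k) ⁆) (chords k) x∈
  ... | inj₂ x∈k = let (i , i<k , c) = ∈-chords⁻ x∈k in i , m≤n⇒m≤1+n i<k , c
  ... | inj₁ x∈new with x∈p∪q⁻ ⁅ w k ⁆ ⁅ d (w k) ⁆ x∈new
  ...   | inj₁ x∈w  = k , ≤-refl , inj₁ (x∈⁅y⁆⇒x≡y _ x∈w)
  ...   | inj₂ x∈dw = k , ≤-refl , inj₂ (x∈⁅y⁆⇒x≡y _ x∈dw)

  ∈-ends : ∀ {i x} → OnChord i x → x ∈ₛ ⁅ w i ⁆ ∪ ⁅ d (w i) ⁆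
  ∈-ends (inj₁ refl) = x∈p∪q⁺ (inj₁ (x∈⁅x⁆ _))
  ∈-ends {i} (inj₂ refl) = x∈p∪q⁺ {p = ⁅ w i ⁆} (inj₂ (x∈⁅x⁆ _))

  ∈-chords⁺ : ∀ {k i x} → i < k → OnChord i x → x ∈ₛ chords k
  ∈-chords⁺ {suc k} i<1+k c with m<1+n⇒m<n∨m≡n i<1+k
  ... | inj₁ i<k  = x∈p∪q⁺ (inj₂ (∈-chords⁺ i<k c))
  ... | inj₂ refl = x∈p∪q⁺ (inj₁ (∈-ends c))

  ∣chords∣ : ∀ k → k ≤ m → ∣ chords k ∣ ≡ 2 * k
  ∣chords∣ zero _ = ∣⊥∣≡0 (2 * n)
  ∣chords∣ (suc k) k<m = begin
    ∣ (⁅ w k ⁆ ∪ ⁅ d (w k) ⁆) ∪ chords k ∣      ≡⟨ ∣p∪q∣≡∣p∣+∣q∣ _ _ new-disjoint ⟩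
    ∣ ⁅ w k ⁆ ∪ ⁅ d (w k) ⁆ ∣ + ∣ chords k ∣    ≡⟨ cong₂ _+_ (∣p∪q∣≡∣p∣+∣q∣ _ _ ends-distinct) (∣chords∣ k (<⇒≤ k<m)) ⟩
    ∣ ⁅ w k ⁆ ∣ + ∣ ⁅ d (w k) ⁆ ∣ + 2 * k        ≡⟨ cong₂ (λ a b → a + b + 2 * k) (∣⁅x⁆∣≡1 (w k)) (∣⁅x⁆∣≡1 (d (w k))) ⟩
    2 + 2 * k                                    ≡⟨ *-suc 2 k ⟨
    2 * suc k                                    ∎
    where
    open ≡-Reasoning
    ends-distinct : ∀ {x} → x ∈ₛ ⁅ w k ⁆ → x ∉ₛ ⁅ d (w k) ⁆
    ends-distinct x∈w x∈dw = proj₂ (isCD (w k)) (trans (sym (x∈⁅y⁆⇒x≡y _ x∈dw)) (x∈⁅y⁆⇒x≡y _ x∈w))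
    new-disjoint : ∀ {x} → x ∈ₛ ⁅ w k ⁆ ∪ ⁅ d (w k) ⁆ → x ∉ₛ chords k
    new-disjoint x∈new x∈old with ∈-chords⁻ x∈old
    ... | i , i<k , c = <-irrefl (OnChord-unique (<-trans i<k k<m) k<m c c′) i<k
      where
      c′ : OnChord k _
      c′ = map-⊎ (x∈⁅y⁆⇒x≡y _) (x∈⁅y⁆⇒x≡y _) (x∈p∪q⁻ _ _ x∈new)

  w<dw : ∀ {i} → i < m → toℕ (w i) < toℕ (d (w i))
  w<dw i<m = InBlock-< (proj₁ (w-blocks i<m)) (proj₂ (w-blocks i<m)) (i<m+i _)

  chord-ends : ∀ {i x} → i < m → OnChord i x → toℕ x ⊓ toℕ (d x) ≡ toℕ (w i) × toℕ x ⊔ toℕ (d x) ≡ toℕ (d (w i))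
  chord-ends i<m (inj₁ refl) = m≤n⇒m⊓n≡m (<⇒≤ (w<dw i<m)) , m≤n⇒m⊔n≡n (<⇒≤ (w<dw i<m))
  chord-ends {i} i<m (inj₂ refl) rewrite proj₁ (isCD (w i)) = m≥n⇒m⊓n≡n (<⇒≤ (w<dw i<m)) , m≥n⇒m⊔n≡m (<⇒≤ (w<dw i<m))

  chords-cross : ∀ {i i′} → i < m → i′ < m → i < i′ →
    Interleave (toℕ (w i)) (toℕ (d (w i))) (toℕ (w i′)) (toℕ (d (w i′)))
  chords-cross i<m i′<m i<i′ = inj₁
    ( InBlock-< (proj₁ (w-blocks i<m)) (proj₁ (w-blocks i′<m)) i<i′
    , InBlock-< (proj₁ (w-blocks i′<m)) (proj₂ (w-blocks i<m)) (<-≤-trans i′<m (m≤m+n m _))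
    , InBlock-< (proj₂ (w-blocks i<m)) (proj₂ (w-blocks i′<m)) (+-monoʳ-< m i<i′) )

  crosses : ∀ x y → x ∈ₛ chords m → y ∈ₛ chords m → y ≢ x → y ≢ d x → Crosses n D x y
  crosses x y x∈ y∈ y≢x y≢dx with ∈-chords⁻ x∈ | ∈-chords⁻ y∈
  ... | i , i<m , cx | i′ , i′<m , cy
    rewrite proj₁ (chord-ends i<m cx) | proj₂ (chord-ends i<m cx)
          | proj₁ (chord-ends i′<m cy) | proj₂ (chord-ends i′<m cy)
    with <-cmp i i′
  ... | tri< i<i′ _ _ = chords-cross i<m i′<m i<i′
  ... | tri> _ _ i>i′ = Interleave-sym (chords-cross i′<m i<m i>i′)
  ... | tri≈ _ refl _ with OnChord-same cx cy
  ...   | inj₁ y≡x  = ⊥-elim (y≢x y≡x)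
  ...   | inj₂ y≡dx = ⊥-elim (y≢dx y≡dx)

  one-per-block : ∀ j → j < 2 * m →
    Σ (Fin (2 * n)) λ x → x ∈ₛ chords m × InBlock n m j x × (∀ y → y ∈ₛ chords m → InBlock n m j y → y ≡ x)
  one-per-block j j<2m with <m+m⇒<m⊎≡m+ (subst (j <_) (cong (m +_) (+-identityʳ m)) j<2m)
  ... | inj₁ j<m = w j , ∈-chords⁺ j<m (inj₁ refl) , proj₁ (w-blocks j<m) , unique
    where
    unique : ∀ y → y ∈ₛ chords m → InBlock n m j y → y ≡ w j
    unique y y∈ y∈j with ∈-chords⁻ {m} y∈
    ... | i , i<m , inj₁ refl = cong w (InBlock-unique (proj₁ (w-blocks i<m)) y∈j)
    ... | i , i<m , inj₂ refl =
      ⊥-elim (<⇒≱ j<m (≤-trans (m≤m+n m i) (≤-reflexive (InBlock-unique (proj₂ (w-blocks i<m)) y∈j))))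
  ... | inj₂ (i , i<m , refl) = d (w i) , ∈-chords⁺ i<m (inj₂ refl) , proj₂ (w-blocks i<m) , unique
    where
    unique : ∀ y → y ∈ₛ chords m → InBlock n m (m + i) y → y ≡ d (w i)
    unique y y∈ y∈j with ∈-chords⁻ {m} y∈
    ... | i′ , i′<m , inj₁ refl =
      ⊥-elim (<⇒≱ i′<m (≤-trans (m≤m+n m i) (≤-reflexive (InBlock-unique y∈j (proj₁ (w-blocks i′<m))))))
    ... | i′ , i′<m , inj₂ refl = cong (d ∘ w) (+-cancelˡ-≡ m _ _ (InBlock-unique (proj₂ (w-blocks i′<m)) y∈j))

  balancedClique : IsBalancedClique n m D (chords m)
  balancedClique =
      (λ x x∈ → let (i , i<m , c) = ∈-chords⁻ {m} x∈ in ∈-chords⁺ i<m (OnChord-partner c))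
    , ∣chords∣ m ≤-refl
    , crosses
    , λ j → one-per-block (toℕ j) (toℕ<n j)

-- Chord diagrams and the probability bound

module ChordDiagrams (n : ℕ) where
  open Matchings {Fin (2 * n)} _≟_

  toDiagram : Pairing → Diagram n
  toDiagram π = tabulate (partnerIn π)

  diagramsFrom : List (Fin (2 * n)) → List (Diagram n)
  diagramsFrom ps = map toDiagram (matchings (2 * n) ps)

  length-diagramsFrom : ∀ ps → length (diagramsFrom ps) ≡ matchingCount (2 * n) (length ps)
  length-diagramsFrom ps = trans (length-map toDiagram (matchings (2 * n) ps)) (length-matchings (2 * n) ps)

  module _ {ps : List (Fin (2 * n))} (ps! : Unique ps) (∈ps : ∀ x → x ∈ ps) where

    diagramsFrom-chord : ∀ {D} → D ∈ diagramsFrom ps → IsChordDiagram n D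
    diagramsFrom-chord D∈ with ∈-map⁻ toDiagram D∈
    ... | π , π∈ , refl = λ x → involutive′ x , fixpointFree (∈ps x) ∘ trans (sym (lookup∘tabulate (partnerIn π) x))
      where
      open IsPerfectMatchingOn (matchings-sound ps! π∈)
      involutive′ : ∀ x → lookup (toDiagram π) (lookup (toDiagram π) x) ≡ x
      involutive′ x rewrite lookup∘tabulate (partnerIn π) x | lookup∘tabulate (partnerIn π) (partnerIn π x) =
        involutive (∈ps x)

    ∈-diagramsFrom : ∀ {D} → length ps ≤ 2 * n → IsChordDiagram n D → D ∈ diagramsFrom ps
    ∈-diagramsFrom {D} len≤ isCD with matchings-complete ps! perfect len≤
      where
      perfect : IsPerfectMatchingOn ps (lookup D)
      perfect = record
        { closed = λ _ → ∈ps _ ; involutive = λ {z} _ → proj₁ (isCD z) ; fixpointFree = λ {z} _ → proj₂ (isCD z) }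
    ... | π , π∈ , agree =
      subst (_∈ diagramsFrom ps) (trans (tabulate-cong (λ z → agree (∈ps z))) (tabulate∘lookup D)) (∈-map⁺ toDiagram π∈)

    diagramsFrom-unique : Unique (diagramsFrom ps)
    diagramsFrom-unique = AllPairs.map⁺ (AllPairs-map (λ {π} {π′} → separate {π} {π′}) (matchings-distinct {2 * n} ps!))
      where
      separate : ∀ {π π′} → DifferOn ps π π′ → toDiagram π ≢ toDiagram π′
      separate {π} {π′} differ eq = differ λ {z} _ →
        trans (sym (lookup∘tabulate (partnerIn π) z))
              (trans (cong (λ D → lookup D z) eq) (lookup∘tabulate (partnerIn π′) z))

choose-below : ∀ {A : Set} {P : ℕ → A → Set} m .{{_ : NonZero m}} → (∀ {i} → i < m → Σ A (P i)) →
  Σ (ℕ → A) λ w → ∀ {i} → i < m → P i (w i)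
choose-below {A} {P} m choice = w , w-spec
  where
  -- beyond m the value is irrelevant; the choice at 0 serves as a default.
  w : ℕ → A
  w i with i <? m
  ... | yes i<m = proj₁ (choice i<m)
  ... | no _    = proj₁ (choice (>-nonZero⁻¹ m))
  w-spec : ∀ {i} → i < m → P i (w i)
  w-spec {i} i<m with i <? m
  ... | yes i<m′ = proj₂ (choice i<m′)
  ... | no i≮m   = ⊥-elim (i≮m i<m)

[q∸p]*A≤q*G : ∀ {p q G B L A} → 1 ≤ p → B + G ≡ L → q * B ≤ L → A ≤ L → (q ∸ p) * A ≤ q * G
[q∸p]*A≤q*G {p} {q} {G} {B} {L} {A} 1≤p B+G≡L q*B≤L A≤L = begin
  (q ∸ p) * A        ≤⟨ *-monoʳ-≤ (q ∸ p) A≤L ⟩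
  (q ∸ p) * L        ≡⟨ *-distribʳ-∸ L q p ⟩
  q * L ∸ p * L      ≤⟨ m≤n+o⇒m∸n≤o (q * L) (p * L) q*L≤ ⟩
  q * G              ∎
  where
  open ≤-Reasoning
  q*L≤ : q * L ≤ p * L + q * G
  q*L≤ = begin
    q * L             ≡⟨ cong (q *_) (sym B+G≡L) ⟩
    q * (B + G)       ≡⟨ *-distribˡ-+ q B G ⟩
    q * B + q * G     ≤⟨ +-monoˡ-≤ (q * G) (≤-trans q*B≤L (m≤n*m L p {{>-nonZero 1≤p}})) ⟩
    p * L + q * G     ∎

module CliqueProbability (a b p q n m : ℕ) .{{_ : NonZero a}} .{{_ : NonZero b}} .{{_ : NonZero m}} (1≤p : 1 ≤ p)
  (large : threshold a b q ≤ n) (bound : MBound a b n m) where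
  open Estimates a b q n m large bound
  open BlockStructure n m hiding (r)
  open ChordDiagrams n
  open Matchings {Fin (2 * n)} _≟_ using (partnerIn; matchings; matchingCount)

  points : List (Fin (2 * n))
  points = allFin (2 * n)

  points! : Unique points
  points! = Unique.allFin⁺ (2 * n)

  allDiagrams : List (Diagram n)
  allDiagrams = diagramsFrom points

  module BlockPair (i : ℕ) = Avoidance (inBlock i) (inBlock (m + i))

  unjoined : ℕ → Diagram n → Bool
  unjoined i D = BlockPair.avoids i (lookup D)

  hasUnjoinedPair : Diagram n → Bool
  hasUnjoinedPair D = any (λ i → unjoined i D) (upTo m)

  block-fits : ∀ {j} → j < 2 * m → suc j * r ≤ 2 * n
  block-fits {j} j<2m = begin
    suc j * r    ≤⟨ *-monoˡ-≤ r j<2m ⟩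
    2 * m * r    ≡⟨ *-assoc 2 m r ⟩
    2 * (m * r)  ≤⟨ *-monoʳ-≤ 2 (subst (_≤ n) (*-comm r m) r*m≤n) ⟩
    2 * n        ∎
    where open ≤-Reasoning

  module BlockFirst {i} (i<m : i < m) where

    ps : List (Fin (2 * n))
    ps = toFront (inBlock i) points

    ps! : Unique ps
    ps! = Unique-toFront (inBlock i) points!

    ∈ps : ∀ x → x ∈ ps
    ∈ps x = ∈-toFront (inBlock i) (∈-allFin x)

    length-ps : length ps ≡ 2 * n
    length-ps = trans (length-toFront (inBlock i) points) (length-tabulate _)

    disjoint : ∀ {z} → T (inBlock i z) → ¬ T (inBlock (m + i) z)
    disjoint {z} z∈A z∈B = <-irrefl (InBlock-unique (inBlock-sound {i} {z} z∈A) (inBlock-sound {m + i} z∈B)) (i<m+i i)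

    first : AllFirst (inBlock i) (s + s) ps
    first = AllFirst-toFront (inBlock i) (s + s) points
      (subst (s + s ≤_) (sym (count-inBlock i (block-fits (<-≤-trans i<m (m≤m+n m _))))) s+s≤r)

    r≤B : r ≤ count (inBlock (m + i)) ps
    r≤B = subst (_≤ count (inBlock (m + i)) ps)
      (count-inBlock (m + i) (block-fits (<-≤-trans (+-monoʳ-< m i<m)
                                                     (≤-reflexive (cong (m +_) (sym (+-identityʳ m)))))))
      (count-mono (inBlock (m + i)) points! (λ x∈ _ → ∈-toFront (inBlock i) x∈))

  unjoined-bound : ∀ {i} → i < m → count (unjoined i) allDiagrams * N ^ s ≤ u ^ s * length allDiagrams
  unjoined-bound {i} i<m = begin
    count (unjoined i) allDiagrams * N ^ s
      ≤⟨ *-monoˡ-≤ (N ^ s) (count-mono (unjoined i) (diagramsFrom-unique points! ∈-allFin) reorder) ⟩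
    count (unjoined i) (diagramsFrom ps) * N ^ s
      ≡⟨ cong (_* N ^ s) (trans (count-map (unjoined i) toDiagram (matchings (2 * n) ps))
                                (count-cong (matchings (2 * n) ps) λ {π} _ → tabulated {π})) ⟩
    count (BlockPair.avoids i ∘ partnerIn) (matchings (2 * n) ps) * N ^ s
      ≤⟨ BlockPair.avoidance-bound i disjoint N r (2 * n) ps s ps! first r≤B
           (≤-reflexive (trans length-ps (sym suc[N]≡2n))) ⟩
    u ^ s * matchingCount (2 * n) (length ps)
      ≡⟨ cong (λ k → u ^ s * matchingCount (2 * n) k) (length-toFront (inBlock i) points) ⟩
    u ^ s * matchingCount (2 * n) (length points)
      ≡⟨ cong (u ^ s *_) (length-diagramsFrom points) ⟨
    u ^ s * length allDiagrams ∎
    where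
    open ≤-Reasoning
    open BlockFirst i<m
    reorder : ∀ {D} → D ∈ allDiagrams → T (unjoined i D) → D ∈ diagramsFrom ps
    reorder D∈ _ = ∈-diagramsFrom ps! ∈ps (≤-reflexive length-ps) (diagramsFrom-chord points! ∈-allFin D∈)
    tabulated : ∀ {π} → unjoined i (toDiagram π) ≡ BlockPair.avoids i (partnerIn π)
    tabulated {π} = BlockPair.avoids-cong i (λ a → cong (inBlock (m + i)) (lookup∘tabulate (partnerIn π) a))

  hasUnjoinedPair-bound : count hasUnjoinedPair allDiagrams * N ^ s ≤ m * (u ^ s * length allDiagrams)
  hasUnjoinedPair-bound = begin
    count hasUnjoinedPair allDiagrams * N ^ s
      ≤⟨ *-monoˡ-≤ (N ^ s) (count-any≤sum unjoined (upTo m) allDiagrams) ⟩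
    sum (map (λ i → count (unjoined i) allDiagrams) (upTo m)) * N ^ s
      ≤⟨ sum-≤-count (const true) _ (N ^ s) _ (upTo m) (λ _ ¬t → ⊥-elim (¬t _)) (λ i∈ _ → unjoined-bound (∈-upTo⁻ i∈)) ⟩
    count (const true) (upTo m) * (u ^ s * length allDiagrams)
      ≡⟨ cong (_* (u ^ s * length allDiagrams)) (trans (count-const-true (upTo m)) (length-upTo m)) ⟩
    m * (u ^ s * length allDiagrams) ∎
    where open ≤-Reasoning

  q*unjoined≤all : q * count hasUnjoinedPair allDiagrams ≤ length allDiagrams
  q*unjoined≤all = *-cancelʳ-≤ _ _ (N ^ s) {{m^n≢0 N s}} (begin
    q * B * N ^ s            ≡⟨ *-assoc q B (N ^ s) ⟩
    q * (B * N ^ s)          ≤⟨ *-monoʳ-≤ q hasUnjoinedPair-bound ⟩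
    q * (m * (u ^ s * L))    ≡⟨ trans (*-assoc (q * m) (u ^ s) L) (*-assoc q m _) ⟨
    q * m * u ^ s * L        ≤⟨ *-monoˡ-≤ L q*m*u^s≤N^s ⟩
    N ^ s * L                ≡⟨ *-comm (N ^ s) L ⟩
    L * N ^ s                ∎)
    where
    open ≤-Reasoning
    B = count hasUnjoinedPair allDiagrams
    L = length allDiagrams

  hasClique : ∀ {D} → IsChordDiagram n D → T (not (hasUnjoinedPair D)) → HasBalancedClique n m D
  hasClique {D} isCD allJoined = chords m , balancedClique
    where
    chord-between : ∀ {i} → i < m → Σ (Fin (2 * n)) λ a → InBlock n m i a × InBlock n m (m + i) (partner n D a)
    chord-between {i} i<m
      with BlockPair.¬avoids⁻ i (λ av → T-not⇒¬T allJoined (any⁺ _ (Any.map (λ { refl → av }) (∈-upTo⁺ i<m))))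
    ... | a , a∈A , Da∈B = a , inBlock-sound {i} a∈A , inBlock-sound {m + i} Da∈B
    w = choose-below m chord-between
    open Clique n m D isCD (proj₁ w) (proj₂ w)

  probability-bound : ProbAtLeastOneMinus n m p q
  probability-bound =
    good , Unique.filter⁺ (T? ∘ (not ∘ hasUnjoinedPair)) allDiagrams! , All.tabulate good-ok , bound-all
    where
    good = filterᵇ (not ∘ hasUnjoinedPair) allDiagrams
    allDiagrams! = diagramsFrom-unique points! ∈-allFin
    good-ok : ∀ {D} → D ∈ good → IsChordDiagram n D × HasBalancedClique n m D
    good-ok {D} D∈ with ∈-filter⁻ (T? ∘ (not ∘ hasUnjoinedPair)) {xs = allDiagrams} D∈
    ... | D∈all , allJoined =
      let isCD = diagramsFrom-chord points! ∈-allFin D∈all in isCD , hasClique {D} isCD allJoined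
    bound-all : (all : List (Diagram n)) → Unique all → All.All (IsChordDiagram n) all →
      (q ∸ p) * length all ≤ q * length good
    bound-all all all! all-chord = [q∸p]*A≤q*G 1≤p
      (count-complement hasUnjoinedPair allDiagrams) q*unjoined≤all
      (length-mono-⊆ all! λ D∈ →
        ∈-diagramsFrom points! ∈-allFin (≤-reflexive (length-tabulate _)) (All.lookup all-chord D∈))

mainTheorem8 : (a b : ℕ) → NonZero a → NonZero b →
    (p q : ℕ) → NonZero p → NonZero q →
    ∃ λ N → ∀ n → N ≤ n → ∀ m → .{{_ : NonZero m}} →
      MBound a b n m → ProbAtLeastOneMinus n m p q
mainTheorem8 a b a≢0 b≢0 p q p≢0 _ = threshold a b q , λ n large m bound →
  CliqueProbability.probability-bound a b p q n m {{a≢0}} {{b≢0}} (>-nonZero⁻¹ p {{p≢0}}) large bound
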